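{- Let $n\ge 3$ be odd and let $D_{2n}=\langle a,b : a^n=b^2=e,\ ba=a^{ -1}b\rangle$. Then the Laplacian eigenvalues of $CSEP(D_{2n})$ are $0$ with multiplicity $1$, $1$ with multiplicity $1$, $n$ with multiplicity $n-2$, $n+1$ with multiplicity $n-1$, and $2n$ with multiplicity $1$.
   Context: For a finite group $G$ and $x\in G$, $[x]$ denotes the conjugacy class of $x$. The conjugacy superenhanced power graph $CSEP(G)$ is the simple graph with vertex set $G$ in which two distinct vertices $x,y$ are adjacent iff there exist $x'\in[x]$, $y'\in[y]$ lying in a common cyclic subgroup of $G$ ($x'=y'$ permitted, so distinct conjugate elements are always adjacent). Laplacian eigenvalues are the eigenvalues of $L=D-A$ ($D$ the degree matrix, $A$ the adjacency matrix). -}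

module Defs where

open import Data.Nat using (ℕ; zero; suc; _+_; _∸_; NonZero)
open import Data.Nat.DivMod using (_mod_)
open import Data.Bool using (Bool; true; false; not)
open import Data.Fin using (Fin; zero; suc; toℕ; splitAt; punchIn)
open import Data.Product using (_×_; _,_; ∃-syntax)
open import Data.Sum using (inj₁; inj₂)
open import Data.Integer as ℤ using (ℤ; +_)
open import Relation.Binary.PropositionalEquality using (_≡_; _≢_)

-- The dihedral group D_{2n} = ⟨a, b | a^n = b^2 = e, ba = a⁻¹b⟩,
-- realised concretely: the pair (i , s) stands for a^i b^s
-- (i ∈ ℤ/n, s ∈ {0,1} encoded as false/true).

module Dihedral (n : ℕ) .{{_ : NonZero n}} where

  D : Set
  D = Fin n × Bool

  addₙ : Fin n → Fin n → Fin n
  addₙ i j = (toℕ i + toℕ j) mod n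

  negₙ : Fin n → Fin n
  negₙ j = (n ∸ toℕ j) mod n

  e : D
  e = (0 mod n , false)

  a : D
  a = (1 mod n , false)

  b : D
  b = (0 mod n , true)

  -- (a^i b^s)(a^j b^t) = a^(i + (-1)^s j) b^(s xor t)
  _·_ : D → D → D
  (i , false) · (j , t) = (addₙ i j , t)
  (i , true)  · (j , t) = (addₙ i (negₙ j) , not t)

  inv : D → D
  inv (i , false) = (negₙ i , false)
  inv (i , true)  = (i , true)

  _^_ : D → ℕ → D
  g ^ zero    = e
  g ^ suc k   = g · (g ^ k)

  _∈[_] : D → D → Set
  y ∈[ x ] = ∃[ g ] y ≡ (g · x) · inv g

  CommonCyclic : D → D → Set
  CommonCyclic x y = ∃[ g ] ∃[ k ] ∃[ m ] (x ≡ g ^ k × y ≡ g ^ m)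

  Adj : D → D → Set
  Adj x y = x ≢ y × ∃[ x' ] ∃[ y' ] (x' ∈[ x ] × y' ∈[ y ] × CommonCyclic x' y')

  elem : Fin (n + n) → D
  elem k with splitAt n k
  ... | inj₁ i = (i , false)
  ... | inj₂ i = (i , true)

Matrix : ℕ → Set
Matrix m = Fin m → Fin m → ℤ

sumFin : ∀ {m} → (Fin m → ℤ) → ℤ
sumFin {zero}  f = + 0
sumFin {suc m} f = f zero ℤ.+ sumFin (λ i → f (suc i))

sign : ℕ → ℤ
sign zero    = + 1
sign (suc k) = ℤ.- sign k

det : ∀ {m} → Matrix m → ℤ
det {zero}  M = + 1
det {suc m} M =
  sumFin (λ j → sign (toℕ j) ℤ.* (M zero j ℤ.* det (λ r c → M (suc r) (punchIn j c))))

δ : ∀ {m} → Fin m → Fin m → ℤ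
δ zero    zero    = + 1
δ zero    (suc j) = + 0
δ (suc i) zero    = + 0
δ (suc i) (suc j) = δ i j

laplacian : ∀ {m} → Matrix m → Matrix m
laplacian A i j = δ i j ℤ.* sumFin (A i) ℤ.- A i j

charPoly : ∀ {m} → Matrix m → ℤ → ℤ
charPoly M x = det (λ i j → x ℤ.* δ i j ℤ.- M i j)

-- For odd n the graph CSEP(D_{2n}) is the identity joined to the disjoint union of a clique on the
-- n - 1 non-trivial rotations (all lie in ⟨a⟩) and a clique on the n reflections (all conjugate);
-- a cyclic subgroup never contains a reflection and a non-trivial rotation together. So every entry
-- of xI - L depends only on whether it is diagonal and on the kinds of its row and column: identity,
-- a, other rotation, b, other reflection. Column operations stated on kinds pull out the factors
-- (x - n)^(n-2), (x - n - 1)^(n-1) and x - 1, and leave a matrix with determinant x (x - 2n); each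
-- kind-level identity is an identity of polynomials in x and n, checked by normalisation.
module Submission where

open import Defs
open import Algebra.Bundles using (AbelianGroup; Monoid)
open import Data.Nat as ℕ using (ℕ; zero; suc; NonZero; z≤n; s≤s)
import Data.Nat.Properties as ℕ
open import Data.Fin as Fin using (Fin; zero; suc; toℕ; punchIn; punchOut; fromℕ<; splitAt; _↑ˡ_; _↑ʳ_)
import Data.Fin.Properties as Fin
open import Data.Bool using (Bool; true; false; T; not; _∧_; _∨_; if_then_else_)
open import Data.Bool.Properties using (T-∧)
open import Data.Bool.ListAction using (all)
open import Data.Empty using (⊥-elim)
open import Data.List using (List; []; _∷_)
import Data.List.Relation.Unary.All as All
open import Data.List.Relation.Unary.All.Properties using (all⁺)
open import Data.List.Relation.Unary.Any using (here; there)
open import Data.List.Membership.Propositional using (_∈_)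
open import Data.Maybe using (just; is-just)
open import Data.Product using (_×_; _,_; proj₁; proj₂; ∃-syntax)
open import Data.Sum using (_⊎_; inj₁; inj₂; [_,_]′)
open import Data.Unit using (tt)
open import Data.Vec using ([]; _∷_)
open import Function using (_∘_; Equivalence)
open import Relation.Nullary using (¬_; yes; no; Dec; contradiction)
open import Relation.Nullary.Reflects using (Reflects; ofʸ; ofⁿ)
open import Relation.Binary using (tri<; tri≈; tri>)
open import Relation.Binary.PropositionalEquality
open ≡-Reasoning

-- The dihedral group

module DihedralProperties (n : ℕ) .{{_ : NonZero n}} where

  open import Data.Nat using (_+_; _*_; _∸_; _%_)
  open import Data.Nat.DivMod using (_mod_; m<n⇒m%n≡m; n%n≡0; m%n%n≡m%n; %-distribˡ-+; [m+n]%n≡m%n; [m+kn]%n≡m%n)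
  open import Data.Nat.Tactic.RingSolver using (solve-∀)
  open Dihedral n

  toℕ-mod : ∀ m → toℕ (m mod n) ≡ m % n
  toℕ-mod m = Fin.toℕ-fromℕ< _

  toℕ%n : ∀ (i : Fin n) → toℕ i % n ≡ toℕ i
  toℕ%n i = m<n⇒m%n≡m (Fin.toℕ<n i)

  %-absorbˡ : ∀ a b → (a % n + b) % n ≡ (a + b) % n
  %-absorbˡ a b = begin
    (a % n + b) % n
      ≡⟨ %-distribˡ-+ (a % n) b n ⟩
    (a % n % n + b % n) % n
      ≡⟨ cong (λ t → (t + b % n) % n) (m%n%n≡m%n a n) ⟩
    (a % n + b % n) % n
      ≡⟨ %-distribˡ-+ a b n ⟨
    (a + b) % n ∎

  %-absorbʳ : ∀ a b → (a + b % n) % n ≡ (a + b) % n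
  %-absorbʳ a b = begin
    (a + b % n) % n
      ≡⟨ cong (_% n) (ℕ.+-comm a (b % n)) ⟩
    (b % n + a) % n
      ≡⟨ %-absorbˡ b a ⟩
    (b + a) % n
      ≡⟨ cong (_% n) (ℕ.+-comm b a) ⟩
    (a + b) % n ∎

  %-absorb₃ : ∀ a b c → (a % n + b % n + c % n) % n ≡ (a + b + c) % n
  %-absorb₃ a b c = begin
    (a % n + b % n + c % n) % n
      ≡⟨ %-absorbʳ (a % n + b % n) c ⟩
    (a % n + b % n + c) % n
      ≡⟨ cong (_% n) (ℕ.+-assoc (a % n) (b % n) c) ⟩
    (a % n + (b % n + c)) % n
      ≡⟨ %-absorbˡ a (b % n + c) ⟩
    (a + (b % n + c)) % n
      ≡⟨ cong (_% n) (swap a (b % n) c) ⟩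
    (b % n + (a + c)) % n
      ≡⟨ %-absorbˡ b (a + c) ⟩
    (b + (a + c)) % n
      ≡⟨ cong (_% n) (sym (swap a b c)) ⟩
    (a + (b + c)) % n
      ≡⟨ cong (_% n) (ℕ.+-assoc a b c) ⟨
    (a + b + c) % n ∎
    where
    swap : ∀ a b c → a + (b + c) ≡ b + (a + c)
    swap = solve-∀

  n∸i+i : ∀ (i : Fin n) → (n ∸ toℕ i) + toℕ i ≡ n
  n∸i+i i = ℕ.m∸n+n≡m (ℕ.<⇒≤ (Fin.toℕ<n i))

  toℕ-e : toℕ (proj₁ e) ≡ 0
  toℕ-e = trans (toℕ-mod 0) (m<n⇒m%n≡m (ℕ.>-nonZero⁻¹ n))

  same-index : ∀ {i j : Fin n} (s : Bool) → toℕ i ≡ toℕ j → _≡_ {A = D} (i , s) (j , s)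
  same-index s i≡j = cong (_, s) (Fin.toℕ-injective i≡j)

  toℕ-negₙ-e : toℕ (negₙ (proj₁ e)) ≡ 0
  toℕ-negₙ-e = begin
    toℕ (negₙ (proj₁ e))
      ≡⟨ toℕ-mod _ ⟩
    (n ∸ toℕ (proj₁ e)) % n
      ≡⟨ cong (λ t → (n ∸ t) % n) toℕ-e ⟩
    n % n
      ≡⟨ n%n≡0 n ⟩
    0 ∎

  ·-identityˡ : ∀ g → e · g ≡ g
  ·-identityˡ (i , s) = same-index s (begin
    toℕ (addₙ (proj₁ e) i)
      ≡⟨ toℕ-mod _ ⟩
    (toℕ (proj₁ e) + toℕ i) % n
      ≡⟨ cong (λ t → (t + toℕ i) % n) toℕ-e ⟩
    toℕ i % n
      ≡⟨ toℕ%n i ⟩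
    toℕ i ∎)

  ·-identityʳ : ∀ g → g · e ≡ g
  ·-identityʳ (i , false) = same-index false (begin
    toℕ (addₙ i (proj₁ e))
      ≡⟨ toℕ-mod _ ⟩
    (toℕ i + toℕ (proj₁ e)) % n
      ≡⟨ cong (λ t → (toℕ i + t) % n) toℕ-e ⟩
    (toℕ i + 0) % n
      ≡⟨ cong (_% n) (ℕ.+-identityʳ (toℕ i)) ⟩
    toℕ i % n
      ≡⟨ toℕ%n i ⟩
    toℕ i ∎)
  ·-identityʳ (i , true) = same-index true (begin
    toℕ (addₙ i (negₙ (proj₁ e)))
      ≡⟨ toℕ-mod _ ⟩
    (toℕ i + toℕ (negₙ (proj₁ e))) % n
      ≡⟨ cong (λ t → (toℕ i + t) % n) toℕ-negₙ-e ⟩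
    (toℕ i + 0) % n
      ≡⟨ cong (_% n) (ℕ.+-identityʳ (toℕ i)) ⟩
    toℕ i % n
      ≡⟨ toℕ%n i ⟩
    toℕ i ∎)

  inv-e : inv e ≡ e
  inv-e = same-index false (trans toℕ-negₙ-e (sym toℕ-e))

  ∈[]-refl : ∀ x → x ∈[ x ]
  ∈[]-refl x = e , sym (trans (cong (_· inv e) (·-identityˡ x)) (trans (cong (x ·_) inv-e) (·-identityʳ x)))

  a^ : ∀ k → a ^ k ≡ (k mod n , false)
  a^ zero    = refl
  a^ (suc k) = trans (cong (a ·_) (a^ k)) (same-index false (begin
    toℕ (addₙ (1 mod n) (k mod n))
      ≡⟨ toℕ-mod _ ⟩
    (toℕ (1 mod n) + toℕ (k mod n)) % n
      ≡⟨ cong₂ (λ u v → (u + v) % n) (toℕ-mod 1) (toℕ-mod k) ⟩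
    (1 % n + k % n) % n
      ≡⟨ %-distribˡ-+ 1 k n ⟨
    suc k % n
      ≡⟨ toℕ-mod (suc k) ⟨
    toℕ (suc k mod n) ∎))

  rotation≡a^ : ∀ (i : Fin n) → (i , false) ≡ a ^ toℕ i
  rotation≡a^ i = sym (trans (a^ (toℕ i)) (same-index false (trans (toℕ-mod (toℕ i)) (toℕ%n i))))

  reflection≡reflection^1 : ∀ (j : Fin n) → (j , true) ≡ (j , true) ^ 1
  reflection≡reflection^1 j = sym (·-identityʳ (j , true))

  reflection-square : ∀ (t : Fin n) → (t , true) · (t , true) ≡ e
  reflection-square t = same-index false (begin
    toℕ (addₙ t (negₙ t))
      ≡⟨ toℕ-mod _ ⟩
    (toℕ t + toℕ (negₙ t)) % n
      ≡⟨ cong (λ u → (toℕ t + u) % n) (toℕ-mod (n ∸ toℕ t)) ⟩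
    (toℕ t + (n ∸ toℕ t) % n) % n
      ≡⟨ %-absorbʳ (toℕ t) (n ∸ toℕ t) ⟩
    (toℕ t + (n ∸ toℕ t)) % n
      ≡⟨ cong (_% n) (trans (ℕ.+-comm (toℕ t) _) (n∸i+i t)) ⟩
    n % n
      ≡⟨ n%n≡0 n ⟩
    0
      ≡⟨ toℕ-e ⟨
    toℕ (proj₁ e) ∎)

  reflection-powers : ∀ (t : Fin n) k → (t , true) ^ k ≡ e ⊎ (t , true) ^ k ≡ (t , true)
  reflection-powers t zero = inj₁ refl
  reflection-powers t (suc k) with reflection-powers t k
  ... | inj₁ tᵏ≡e = inj₂ (trans (cong ((t , true) ·_) tᵏ≡e) (·-identityʳ (t , true)))
  ... | inj₂ tᵏ≡t = inj₁ (trans (cong ((t , true) ·_) tᵏ≡t) (reflection-square t))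

  rotation-powers : ∀ (t : Fin n) k → proj₂ ((t , false) ^ k) ≡ false
  rotation-powers t zero    = refl
  rotation-powers t (suc k) = rotation-powers t k

  conjugate-reflection : ∀ g (j : Fin n) → proj₂ ((g · (j , true)) · inv g) ≡ true
  conjugate-reflection (k , false) j = refl
  conjugate-reflection (k , true)  j = refl

  conjugate-rotation : ∀ g (i : Fin n) → toℕ i ≢ 0 →
    proj₂ ((g · (i , false)) · inv g) ≡ false × toℕ (proj₁ ((g · (i , false)) · inv g)) ≢ 0
  conjugate-rotation (k , false) i i≢0 = refl , λ eq → i≢0 (trans (sym index) eq)
    where
    regroup : ∀ k i w → k + i + w ≡ i + (w + k)
    regroup = solve-∀
    index : toℕ (addₙ (addₙ k i) (negₙ k)) ≡ toℕ i
    index = begin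
      toℕ (addₙ (addₙ k i) (negₙ k))
        ≡⟨ toℕ-mod _ ⟩
      (toℕ (addₙ k i) + toℕ (negₙ k)) % n
        ≡⟨ cong₂ (λ u v → (u + v) % n) (toℕ-mod _) (toℕ-mod _) ⟩
      ((toℕ k + toℕ i) % n + (n ∸ toℕ k) % n) % n
        ≡⟨ %-distribˡ-+ (toℕ k + toℕ i) (n ∸ toℕ k) n ⟨
      (toℕ k + toℕ i + (n ∸ toℕ k)) % n
        ≡⟨ cong (_% n) (trans (regroup (toℕ k) (toℕ i) _) (cong (toℕ i +_) (n∸i+i k))) ⟩
      (toℕ i + n) % n
        ≡⟨ [m+n]%n≡m%n (toℕ i) n ⟩
      toℕ i % n
        ≡⟨ toℕ%n i ⟩
      toℕ i ∎
  conjugate-rotation (k , true) i i≢0 = refl , λ eq → n∸i≢0 (trans (sym index) eq)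
    where
    regroup : ∀ k v w → k + v + w ≡ (w + k) + v
    regroup = solve-∀
    n∸i<n : n ∸ toℕ i ℕ.< n
    n∸i<n = ℕ.∸-monoʳ-< (ℕ.n≢0⇒n>0 i≢0) (ℕ.<⇒≤ (Fin.toℕ<n i))
    n∸i≢0 : n ∸ toℕ i ≢ 0
    n∸i≢0 eq = ℕ.<⇒≱ (Fin.toℕ<n i) (ℕ.m∸n≡0⇒m≤n eq)
    index : toℕ (addₙ (addₙ k (negₙ i)) (negₙ k)) ≡ n ∸ toℕ i
    index = begin
      toℕ (addₙ (addₙ k (negₙ i)) (negₙ k))
        ≡⟨ toℕ-mod _ ⟩
      (toℕ (addₙ k (negₙ i)) + toℕ (negₙ k)) % n
        ≡⟨ cong₂ (λ u v → (u + v) % n) (toℕ-mod _) (toℕ-mod _) ⟩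
      ((toℕ k + toℕ (negₙ i)) % n + (n ∸ toℕ k) % n) % n
        ≡⟨ %-distribˡ-+ (toℕ k + toℕ (negₙ i)) (n ∸ toℕ k) n ⟨
      (toℕ k + toℕ (negₙ i) + (n ∸ toℕ k)) % n
        ≡⟨ cong (λ t → (toℕ k + t + (n ∸ toℕ k)) % n) (toℕ-mod _) ⟩
      (toℕ k + (n ∸ toℕ i) % n + (n ∸ toℕ k)) % n
        ≡⟨ cong (_% n) (regroup (toℕ k) _ (n ∸ toℕ k)) ⟩
      ((n ∸ toℕ k) + toℕ k + (n ∸ toℕ i) % n) % n
        ≡⟨ %-absorbʳ _ (n ∸ toℕ i) ⟩
      ((n ∸ toℕ k) + toℕ k + (n ∸ toℕ i)) % n
        ≡⟨ cong (λ t → (t + (n ∸ toℕ i)) % n) (n∸i+i k) ⟩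
      (n + (n ∸ toℕ i)) % n
        ≡⟨ cong (_% n) (ℕ.+-comm n _) ⟩
      ((n ∸ toℕ i) + n) % n
        ≡⟨ [m+n]%n≡m%n (n ∸ toℕ i) n ⟩
      (n ∸ toℕ i) % n
        ≡⟨ m<n⇒m%n≡m n∸i<n ⟩
      n ∸ toℕ i ∎

  -- For n = 2h + 1, conjugating b a^j by b a^k with k = (i + j)(h + 1) gives b a^(2k - j) = b a^i.
  reflections-conjugate : ∀ h → n ≡ suc (2 * h) → ∀ (i j : Fin n) → (i , true) ∈[ (j , true) ]
  reflections-conjugate h n≡2h+1 i j = (k , true) , sym (same-index true index)
    where
    X = (toℕ i + toℕ j) * suc h
    k : Fin n
    k = X mod n
    regroup : ∀ i j h w → (i + j) * suc h + w + (i + j) * suc h ≡ i + (w + j) + (i + j) * suc (2 * h)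
    regroup = solve-∀
    double : X + (n ∸ toℕ j) + X ≡ (toℕ i + n) + (toℕ i + toℕ j) * n
    double = begin
      X + (n ∸ toℕ j) + X
        ≡⟨ regroup (toℕ i) (toℕ j) h (n ∸ toℕ j) ⟩
      toℕ i + ((n ∸ toℕ j) + toℕ j) + (toℕ i + toℕ j) * suc (2 * h)
        ≡⟨ cong₂ (λ u v → toℕ i + u + (toℕ i + toℕ j) * v) (n∸i+i j) (sym n≡2h+1) ⟩
      (toℕ i + n) + (toℕ i + toℕ j) * n ∎
    index : toℕ (addₙ (addₙ k (negₙ j)) k) ≡ toℕ i
    index = begin
      toℕ (addₙ (addₙ k (negₙ j)) k)
        ≡⟨ toℕ-mod _ ⟩
      (toℕ (addₙ k (negₙ j)) + toℕ k) % n
        ≡⟨ cong (λ t → (t + toℕ k) % n) (toℕ-mod _) ⟩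
      ((toℕ k + toℕ (negₙ j)) % n + toℕ k) % n
        ≡⟨ %-absorbˡ (toℕ k + toℕ (negₙ j)) (toℕ k) ⟩
      (toℕ k + toℕ (negₙ j) + toℕ k) % n
        ≡⟨ cong₂ (λ u v → (u + v + u) % n) (toℕ-mod X) (toℕ-mod _) ⟩
      (X % n + (n ∸ toℕ j) % n + X % n) % n
        ≡⟨ %-absorb₃ X (n ∸ toℕ j) X ⟩
      (X + (n ∸ toℕ j) + X) % n
        ≡⟨ cong (_% n) double ⟩
      ((toℕ i + n) + (toℕ i + toℕ j) * n) % n
        ≡⟨ [m+kn]%n≡m%n (toℕ i + n) (toℕ i + toℕ j) n ⟩
      (toℕ i + n) % n
        ≡⟨ [m+n]%n≡m%n (toℕ i) n ⟩
      toℕ i % n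
        ≡⟨ toℕ%n i ⟩
      toℕ i ∎

  rotation-reflection-not-cocyclic : ∀ x y → proj₂ x ≡ false → toℕ (proj₁ x) ≢ 0 → proj₂ y ≡ true →
    ¬ CommonCyclic x y
  rotation-reflection-not-cocyclic x y x-rot x≢e y-refl ((t , false) , k , m , x≡gᵏ , y≡gᵐ) =
    contradiction (trans (sym (rotation-powers t m)) (trans (cong proj₂ (sym y≡gᵐ)) y-refl)) λ ()
  rotation-reflection-not-cocyclic x y x-rot x≢e y-refl ((t , true) , k , m , x≡gᵏ , y≡gᵐ)
    with reflection-powers t k
  ... | inj₁ gᵏ≡e = x≢e (trans (cong (toℕ ∘ proj₁) (trans x≡gᵏ gᵏ≡e)) toℕ-e)
  ... | inj₂ gᵏ≡g = contradiction (trans (sym x-rot) (cong proj₂ (trans x≡gᵏ gᵏ≡g))) λ ()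

  -- Adj x y of Defs is x ≢ y × Linked x y.
  Linked : D → D → Set
  Linked x y = ∃[ x′ ] ∃[ y′ ] (x′ ∈[ x ] × y′ ∈[ y ] × CommonCyclic x′ y′)

  linked-sym : ∀ {x y} → Linked x y → Linked y x
  linked-sym (x′ , y′ , x′∈x , y′∈y , g , k , m , x′≡gᵏ , y′≡gᵐ) =
    y′ , x′ , y′∈y , x′∈x , g , m , k , y′≡gᵐ , x′≡gᵏ

  linked-rotations : ∀ (i j : Fin n) → Linked (i , false) (j , false)
  linked-rotations i j =
    (i , false) , (j , false) , ∈[]-refl _ , ∈[]-refl _ , a , toℕ i , toℕ j , rotation≡a^ i , rotation≡a^ j

  linked-reflections : ∀ h → n ≡ suc (2 * h) → ∀ (i j : Fin n) → Linked (i , true) (j , true)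
  linked-reflections h n≡2h+1 i j =
    (i , true) , (i , true) , ∈[]-refl _ , reflections-conjugate h n≡2h+1 i j ,
    (i , true) , 1 , 1 , reflection≡reflection^1 i , reflection≡reflection^1 i

  linked-identity-reflection : ∀ (i j : Fin n) → toℕ i ≡ 0 → Linked (i , false) (j , true)
  linked-identity-reflection i j i≡0 =
    (i , false) , (j , true) , ∈[]-refl _ , ∈[]-refl _ ,
    (j , true) , 0 , 1 , same-index false (trans i≡0 (sym toℕ-e)) , reflection≡reflection^1 j

  unlinked-rotation-reflection : ∀ (i j : Fin n) → toℕ i ≢ 0 → ¬ Linked (i , false) (j , true)
  unlinked-rotation-reflection i j i≢0 (x′ , y′ , (g , x′≡) , (g′ , y′≡) , cocyclic) =
    rotation-reflection-not-cocyclic x′ y′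
      (trans (cong proj₂ x′≡) (proj₁ (conjugate-rotation g i i≢0)))
      (λ x′≡e → proj₂ (conjugate-rotation g i i≢0) (trans (cong (toℕ ∘ proj₁) (sym x′≡)) x′≡e))
      (trans (cong proj₂ y′≡) (conjugate-reflection g′ j))
      cocyclic

open import Data.Integer as ℤ using (ℤ; +_; _+_; _*_; -_; _-_)
import Data.Integer.Properties as ℤ
open import Data.Integer.Solver using (module +-*-Solver)
open import Data.Integer.Tactic.RingSolver using (solve-∀)
open import Algebra.Properties.Semiring.Sum ℤ.+-*-semiring
  using (sum; sum-cong-≗; sum-remove; sum-replicate-zero; ∑-distrib-+; *-distribˡ-sum)
open import Algebra.Properties.Group (AbelianGroup.group ℤ.+-0-abelianGroup) using (inverseʳ-unique)
open import Algebra.Properties.CommutativeMonoid.Sum ℤ.*-1-commutativeMonoid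
  using () renaming (sum to product; sum-remove to product-remove; sum-cong-≗ to product-cong-≗;
                     sum-replicate-zero to product-replicate-one)

sumFin≡sum : ∀ {m} (f : Fin m → ℤ) → sumFin f ≡ sum f
sumFin≡sum {zero}  f = refl
sumFin≡sum {suc m} f = cong (_+_ (f zero)) (sumFin≡sum (f ∘ suc))

sum-zero : ∀ {m} {f : Fin m → ℤ} → (∀ i → f i ≡ + 0) → sum f ≡ + 0
sum-zero {m} f≡0 = trans (sum-cong-≗ f≡0) (sum-replicate-zero m)

sum-single : ∀ {m} (f : Fin m → ℤ) k → (∀ j → j ≢ k → f j ≡ + 0) → sum f ≡ f k
sum-single {suc m} f k f≡0 = begin
  sum f
    ≡⟨ sum-remove f ⟩
  f k + sum (f ∘ punchIn k)
    ≡⟨ cong (_+_ (f k)) (sum-zero (λ i → f≡0 _ (Fin.punchInᵢ≢i k i))) ⟩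
  f k + + 0
    ≡⟨ ℤ.+-identityʳ (f k) ⟩
  f k ∎

sum-update : ∀ {m} (f g : Fin (suc m) → ℤ) k → (∀ l → l ≢ k → f l ≡ g l) → sum f ≡ sum g + (f k - g k)
sum-update f g k f≡g = begin
  sum f
    ≡⟨ sum-remove f ⟩
  f k + sum (f ∘ punchIn k)
    ≡⟨ cong (_+_ (f k)) (sum-cong-≗ (λ i → f≡g _ (Fin.punchInᵢ≢i k i))) ⟩
  f k + sum (g ∘ punchIn k)
    ≡⟨ regroup (f k) (g k) _ ⟩
  (g k + sum (g ∘ punchIn k)) + (f k - g k)
    ≡⟨ cong (_+ (f k - g k)) (sum-remove g) ⟨
  sum g + (f k - g k) ∎
  where
  regroup : ∀ a b s → a + s ≡ (b + s) + (a - b)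
  regroup = solve-∀

sum-pair : ∀ {m} (f : Fin (suc m) → ℤ) {k l} → k ≢ l → f k + f l ≡ + 0 →
  (∀ j → j ≢ k → j ≢ l → f j ≡ + 0) → sum f ≡ + 0
sum-pair f {k} {l} k≢l cancel f≡0 = begin
  sum f
    ≡⟨ sum-remove f ⟩
  f k + sum (f ∘ punchIn k)
    ≡⟨ cong (_+_ (f k)) (sum-single (f ∘ punchIn k) (punchOut k≢l) rest) ⟩
  f k + f (punchIn k (punchOut k≢l))
    ≡⟨ cong (λ j → f k + f j) (Fin.punchIn-punchOut k≢l) ⟩
  f k + f l
    ≡⟨ cancel ⟩
  + 0 ∎
  where
  rest : ∀ i → i ≢ punchOut k≢l → f (punchIn k i) ≡ + 0
  rest i i≢l′ = f≡0 _ (Fin.punchInᵢ≢i k i) λ eq →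
    i≢l′ (Fin.punchIn-injective k i _ (trans eq (sym (Fin.punchIn-punchOut k≢l))))

product-one : ∀ {m} {f : Fin m → ℤ} → (∀ i → f i ≡ + 1) → product f ≡ + 1
product-one {m} f≡1 = trans (product-cong-≗ f≡1) (product-replicate-one m)

product-single : ∀ {m} (f : Fin m → ℤ) k → (∀ j → j ≢ k → f j ≡ + 1) → product f ≡ f k
product-single {suc m} f k f≡1 = begin
  product f
    ≡⟨ product-remove f ⟩
  f k * product (f ∘ punchIn k)
    ≡⟨ cong (f k *_) (product-one (λ i → f≡1 _ (Fin.punchInᵢ≢i k i))) ⟩
  f k * + 1
    ≡⟨ ℤ.*-identityʳ (f k) ⟩
  f k ∎

product-zero : ∀ {m} (f : Fin m → ℤ) k → f k ≡ + 0 → product f ≡ + 0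
product-zero {suc m} f k fk≡0 = begin
  product f
    ≡⟨ product-remove f ⟩
  f k * product (f ∘ punchIn k)
    ≡⟨ cong (_* product (f ∘ punchIn k)) fk≡0 ⟩
  + 0 * product (f ∘ punchIn k)
    ≡⟨ ℤ.*-zeroˡ (product (f ∘ punchIn k)) ⟩
  + 0 ∎

module _ {c ℓ} (M : Monoid c ℓ) where
  private module M = Monoid M
  open M using (Carrier; _≈_; _∙_)
  open import Algebra.Properties.Monoid.Sum M using () renaming (sum to ∑)

  ∑-splitAt : ∀ m {n} (f : Fin (m ℕ.+ n) → Carrier) → ∑ f ≈ ∑ (f ∘ (_↑ˡ n)) ∙ ∑ (f ∘ (m ↑ʳ_))
  ∑-splitAt zero    f = M.sym (M.identityˡ (∑ f))
  ∑-splitAt (suc m) f = M.trans (M.∙-congˡ (∑-splitAt m (f ∘ suc))) (M.sym (M.assoc _ _ _))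

sum-splitAt : ∀ m {n} (f : Fin (m ℕ.+ n) → ℤ) → sum f ≡ sum (f ∘ (_↑ˡ n)) + sum (f ∘ (m ↑ʳ_))
sum-splitAt = ∑-splitAt ℤ.+-0-monoid

product-splitAt : ∀ m {n} (f : Fin (m ℕ.+ n) → ℤ) → product f ≡ product (f ∘ (_↑ˡ n)) * product (f ∘ (m ↑ʳ_))
product-splitAt = ∑-splitAt ℤ.*-1-monoid

sum-const : ∀ m (a : ℤ) → sum {m} (λ _ → a) ≡ + m * a
sum-const zero    a = sym (ℤ.*-zeroˡ a)
sum-const (suc m) a = trans (cong (_+_ a) (sum-const m a)) (sym (ℤ.suc-* (+ m) a))

product-const : ∀ m (a : ℤ) → product {m} (λ _ → a) ≡ a ℤ.^ m
product-const zero    a = refl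
product-const (suc m) a = cong (a *_) (product-const m a)

toℕ-punchIn-< : ∀ {m} (i : Fin (suc m)) (j : Fin m) → toℕ j ℕ.< toℕ i → toℕ (punchIn i j) ≡ toℕ j
toℕ-punchIn-< (suc i) zero    _         = refl
toℕ-punchIn-< (suc i) (suc j) (s≤s j<i) = cong suc (toℕ-punchIn-< i j j<i)

toℕ-punchIn-≥ : ∀ {m} (i : Fin (suc m)) (j : Fin m) → toℕ i ℕ.≤ toℕ j → toℕ (punchIn i j) ≡ suc (toℕ j)
toℕ-punchIn-≥ zero    j       _         = refl
toℕ-punchIn-≥ (suc i) (suc j) (s≤s i≤j) = cong suc (toℕ-punchIn-≥ i j i≤j)

data PunchInView {m} (i : Fin (suc m)) (j : Fin m) : Set where
  below : toℕ j ℕ.< toℕ i → toℕ (punchIn i j) ≡ toℕ j → PunchInView i j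
  above : toℕ i ℕ.≤ toℕ j → toℕ (punchIn i j) ≡ suc (toℕ j) → PunchInView i j

punchInView : ∀ {m} (i : Fin (suc m)) (j : Fin m) → PunchInView i j
punchInView i j with toℕ j ℕ.<? toℕ i
... | yes j<i = below j<i (toℕ-punchIn-< i j j<i)
... | no  j≮i = above (ℕ.≮⇒≥ j≮i) (toℕ-punchIn-≥ i j (ℕ.≮⇒≥ j≮i))

-- Determinants

δ-diagonal : ∀ {m} (i : Fin m) → δ i i ≡ + 1
δ-diagonal zero    = refl
δ-diagonal (suc i) = δ-diagonal i

δ-offDiagonal : ∀ {m} {i j : Fin m} → i ≢ j → δ i j ≡ + 0
δ-offDiagonal {i = zero}  {zero}  i≢j = ⊥-elim (i≢j refl)
δ-offDiagonal {i = zero}  {suc j} _   = refl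
δ-offDiagonal {i = suc i} {zero}  _   = refl
δ-offDiagonal {i = suc i} {suc j} i≢j = δ-offDiagonal (i≢j ∘ cong suc)

minor : ∀ {m} → Matrix (suc m) → Fin (suc m) → Matrix m
minor M j r c = M (suc r) (punchIn j c)

cofactorTerm : ∀ {m} → Matrix (suc m) → Fin (suc m) → ℤ
cofactorTerm M j = sign (toℕ j) * (M zero j * det (minor M j))

det-expand : ∀ {m} (M : Matrix (suc m)) → det M ≡ sum (cofactorTerm M)
det-expand M = sumFin≡sum (cofactorTerm M)

det-cong : ∀ {m} {A B : Matrix m} → (∀ r c → A r c ≡ B r c) → det A ≡ det B
det-cong {zero}          A≡B = refl
det-cong {suc m} {A} {B} A≡B = begin
  det A
    ≡⟨ det-expand A ⟩
  sum (cofactorTerm A)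
    ≡⟨ sum-cong-≗ term ⟩
  sum (cofactorTerm B)
    ≡⟨ det-expand B ⟨
  det B ∎
  where
  term : ∀ j → cofactorTerm A j ≡ cofactorTerm B j
  term j = cong₂ (λ a d → sign (toℕ j) * (a * d))
                 (A≡B zero j) (det-cong (λ r c → A≡B (suc r) (punchIn j c)))

cofactorTerm-zero : ∀ {m} (M : Matrix (suc m)) j → det (minor M j) ≡ + 0 → cofactorTerm M j ≡ + 0
cofactorTerm-zero M j d≡0 = begin
  sign (toℕ j) * (M zero j * det (minor M j))
    ≡⟨ cong (λ d → sign (toℕ j) * (M zero j * d)) d≡0 ⟩
  sign (toℕ j) * (M zero j * + 0)
    ≡⟨ cong (sign (toℕ j) *_) (ℤ.*-zeroʳ (M zero j)) ⟩
  sign (toℕ j) * + 0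
    ≡⟨ ℤ.*-zeroʳ (sign (toℕ j)) ⟩
  + 0 ∎

det-row-single : ∀ {m} (M : Matrix (suc m)) k → (∀ j → j ≢ k → M zero j ≡ + 0) →
  det M ≡ cofactorTerm M k
det-row-single M k M≡0 = trans (det-expand M) (sum-single (cofactorTerm M) k term)
  where
  term : ∀ j → j ≢ k → cofactorTerm M j ≡ + 0
  term j j≢k = begin
    sign (toℕ j) * (M zero j * det (minor M j))
      ≡⟨ cong (λ a → sign (toℕ j) * (a * det (minor M j))) (M≡0 j j≢k) ⟩
    sign (toℕ j) * (+ 0 * det (minor M j))
      ≡⟨ ℤ.*-zeroʳ (sign (toℕ j)) ⟩
    + 0 ∎

det-upper-triangular : ∀ {m} (A : Matrix m) → (∀ r c → toℕ c ℕ.< toℕ r → A r c ≡ + 0) →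
  det A ≡ product (λ i → A i i)
det-upper-triangular {zero}  A A≡0 = refl
det-upper-triangular {suc m} A A≡0 = begin
  det A
    ≡⟨ det-expand A ⟩
  sum (cofactorTerm A)
    ≡⟨ sum-single (cofactorTerm A) zero term ⟩
  + 1 * (A zero zero * det (minor A zero))
    ≡⟨ ℤ.*-identityˡ _ ⟩
  A zero zero * det (minor A zero)
    ≡⟨ cong (A zero zero *_) (det-upper-triangular (minor A zero) (minor-upper zero)) ⟩
  A zero zero * product (λ i → A (suc i) (suc i)) ∎
  where
  minor-upper : ∀ j r c → toℕ c ℕ.< toℕ r → minor A j r c ≡ + 0
  minor-upper j r c c<r with punchInView j c
  ... | below _ eq = A≡0 (suc r) _ (subst (ℕ._< suc (toℕ r)) (sym eq) (ℕ.m<n⇒m<1+n c<r))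
  ... | above _ eq = A≡0 (suc r) _ (subst (ℕ._< suc (toℕ r)) (sym eq) (s≤s c<r))
  -- the minor along a later column has a zero on its diagonal
  term : ∀ j → j ≢ zero → cofactorTerm A j ≡ + 0
  term zero    j≢0 = ⊥-elim (j≢0 refl)
  term (suc j) _   = cofactorTerm-zero A (suc j) (begin
    det (minor A (suc j))
      ≡⟨ det-upper-triangular _ (minor-upper (suc j)) ⟩
    product (λ i → A (suc i) (punchIn (suc j) i))
      ≡⟨ product-zero _ j (A≡0 (suc j) _ diagonal-below) ⟩
    + 0 ∎)
    where
    diagonal-below : toℕ (punchIn (suc j) j) ℕ.< suc (toℕ j)
    diagonal-below = subst (ℕ._< suc (toℕ j)) (sym (toℕ-punchIn-< (suc j) j (ℕ.n<1+n (toℕ j)))) (ℕ.n<1+n (toℕ j))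

AgreeOffColumn : ∀ {m} → Fin m → Matrix m → Matrix m → Set
AgreeOffColumn k A B = ∀ r c → c ≢ k → A r c ≡ B r c

minor-agreeOffColumn-self : ∀ {m} {A B : Matrix (suc m)} k → AgreeOffColumn k A B →
  ∀ r c → minor A k r c ≡ minor B k r c
minor-agreeOffColumn-self k A~B r c = A~B (suc r) _ (Fin.punchInᵢ≢i k c)

minor-agreeOffColumn : ∀ {m} {A B : Matrix (suc m)} {j k} (j≢k : j ≢ k) → AgreeOffColumn k A B →
  AgreeOffColumn (punchOut j≢k) (minor A j) (minor B j)
minor-agreeOffColumn {j = j} j≢k A~B r c c≢k′ = A~B (suc r) _ λ eq →
  c≢k′ (Fin.punchIn-injective j c _ (trans eq (sym (Fin.punchIn-punchOut j≢k))))

minor-column : ∀ {m} (A : Matrix (suc m)) {j k} (j≢k : j ≢ k) r → minor A j r (punchOut j≢k) ≡ A (suc r) k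
minor-column A j≢k r = cong (A (suc r)) (Fin.punchIn-punchOut j≢k)

det-additive : ∀ {m} k {A B C : Matrix m} → AgreeOffColumn k A C → AgreeOffColumn k B C →
  (∀ r → C r k ≡ A r k + B r k) → det C ≡ det A + det B
det-additive {suc m} k {A} {B} {C} A~C B~C Cₖ = begin
  det C
    ≡⟨ det-expand C ⟩
  sum (cofactorTerm C)
    ≡⟨ sum-cong-≗ term ⟩
  sum (λ j → cofactorTerm A j + cofactorTerm B j)
    ≡⟨ ∑-distrib-+ (cofactorTerm A) (cofactorTerm B) ⟩
  sum (cofactorTerm A) + sum (cofactorTerm B)
    ≡⟨ cong₂ _+_ (det-expand A) (det-expand B) ⟨
  det A + det B ∎
  where
  term : ∀ j → cofactorTerm C j ≡ cofactorTerm A j + cofactorTerm B j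
  term j with j Fin.≟ k
  ... | yes refl = begin
    s * (C zero j * det (minor C j))
      ≡⟨ cong (λ c → s * (c * det (minor C j))) (Cₖ zero) ⟩
    s * ((A zero j + B zero j) * det (minor C j))
      ≡⟨ distribʳ s (A zero j) (B zero j) (det (minor C j)) ⟩
    s * (A zero j * det (minor C j)) + s * (B zero j * det (minor C j))
      ≡⟨ cong₂ (λ u v → s * (A zero j * u) + s * (B zero j * v))
               (det-cong (minor-agreeOffColumn-self j A~C)) (det-cong (minor-agreeOffColumn-self j B~C)) ⟨
    cofactorTerm A j + cofactorTerm B j ∎
    where
    s = sign (toℕ j)
    distribʳ : ∀ s a b d → s * ((a + b) * d) ≡ s * (a * d) + s * (b * d)
    distribʳ = solve-∀
  ... | no j≢k = begin
    s * (C zero j * det (minor C j))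
      ≡⟨ cong (λ d → s * (C zero j * d)) minor-additive ⟩
    s * (C zero j * (det (minor A j) + det (minor B j)))
      ≡⟨ distribˡ s (C zero j) (det (minor A j)) (det (minor B j)) ⟩
    s * (C zero j * det (minor A j)) + s * (C zero j * det (minor B j))
      ≡⟨ cong₂ (λ a b → s * (a * det (minor A j)) + s * (b * det (minor B j))) (A~C zero j j≢k) (B~C zero j j≢k) ⟨
    cofactorTerm A j + cofactorTerm B j ∎
    where
    s = sign (toℕ j)
    distribˡ : ∀ s c d e → s * (c * (d + e)) ≡ s * (c * d) + s * (c * e)
    distribˡ = solve-∀
    minor-additive : det (minor C j) ≡ det (minor A j) + det (minor B j)
    minor-additive = det-additive (punchOut j≢k) (minor-agreeOffColumn j≢k A~C) (minor-agreeOffColumn j≢k B~C) λ r →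
      trans (minor-column C j≢k r) (trans (Cₖ (suc r)) (sym (cong₂ _+_ (minor-column A j≢k r) (minor-column B j≢k r))))

det-scale-columns : ∀ {m} (s : Fin m → ℤ) {A C : Matrix m} → (∀ r c → C r c ≡ s c * A r c) →
  det C ≡ product s * det A
det-scale-columns {zero}  s         C≡sA = refl
det-scale-columns {suc m} s {A} {C} C≡sA = begin
  det C
    ≡⟨ det-expand C ⟩
  sum (cofactorTerm C)
    ≡⟨ sum-cong-≗ term ⟩
  sum (λ j → product s * cofactorTerm A j)
    ≡⟨ *-distribˡ-sum (product s) (cofactorTerm A) ⟨
  product s * sum (cofactorTerm A)
    ≡⟨ cong (product s *_) (det-expand A) ⟨
  product s * det A ∎
  where
  regroup : ∀ σ a b d e → σ * ((a * b) * (d * e)) ≡ (a * d) * (σ * (b * e))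
  regroup = solve-∀
  term : ∀ j → cofactorTerm C j ≡ product s * cofactorTerm A j
  term j = begin
    sign (toℕ j) * (C zero j * det (minor C j))
      ≡⟨ cong₂ (λ c d → sign (toℕ j) * (c * d)) (C≡sA zero j)
               (det-scale-columns (s ∘ punchIn j) (λ r c → C≡sA (suc r) (punchIn j c))) ⟩
    sign (toℕ j) * ((s j * A zero j) * (product (s ∘ punchIn j) * det (minor A j)))
      ≡⟨ regroup (sign (toℕ j)) (s j) (A zero j) (product (s ∘ punchIn j)) (det (minor A j)) ⟩
    (s j * product (s ∘ punchIn j)) * cofactorTerm A j
      ≡⟨ cong (_* cofactorTerm A j) (product-remove s) ⟨
    product s * cofactorTerm A j ∎

det-scale-column : ∀ {m} k (s : ℤ) {A C : Matrix m} → AgreeOffColumn k A C →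
  (∀ r → C r k ≡ s * A r k) → det C ≡ s * det A
det-scale-column {m} k s {A} {C} A~C Cₖ = begin
  det C
    ≡⟨ det-scale-columns factor C≡factor*A ⟩
  product factor * det A
    ≡⟨ cong (_* det A) (trans (product-single factor k factor-off) factor-at) ⟩
  s * det A ∎
  where
  factor : Fin m → ℤ
  factor c with c Fin.≟ k
  ... | yes _ = s
  ... | no  _ = + 1
  factor-at : factor k ≡ s
  factor-at with k Fin.≟ k
  ... | yes _   = refl
  ... | no  k≢k = ⊥-elim (k≢k refl)
  factor-off : ∀ c → c ≢ k → factor c ≡ + 1
  factor-off c c≢k with c Fin.≟ k
  ... | yes c≡k = ⊥-elim (c≢k c≡k)
  ... | no  _   = refl
  C≡factor*A : ∀ r c → C r c ≡ factor c * A r c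
  C≡factor*A r c with c Fin.≟ k
  ... | yes refl = Cₖ r
  ... | no  c≢k  = trans (sym (A~C r c c≢k)) (sym (ℤ.*-identityˡ (A r c)))

AdjacentColumns : ∀ {m} → Fin m → Fin m → Set
AdjacentColumns k l = toℕ l ≡ suc (toℕ k)

adjacent⇒≢ : ∀ {m} {k l : Fin m} → AdjacentColumns k l → k ≢ l
adjacent⇒≢ kl k≡l = ℕ.1+n≢n (sym (trans (cong toℕ k≡l) kl))

minor-adjacent : ∀ {m} (A : Matrix (suc m)) {k l} → AdjacentColumns k l → (∀ r → A r k ≡ A r l) →
  ∀ r c → minor A k r c ≡ minor A l r c
minor-adjacent A {k} {l} kl Aₖ≡Aₗ r c with punchInView k c | punchInView l c
... | below _   eq₁ | below _   eq₂ = cong (A (suc r)) (Fin.toℕ-injective (trans eq₁ (sym eq₂)))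
... | above _   eq₁ | above _   eq₂ = cong (A (suc r)) (Fin.toℕ-injective (trans eq₁ (sym eq₂)))
... | below c<k _   | above l≤c _   = ⊥-elim (ℕ.<⇒≱ (ℕ.<-trans c<k (subst (toℕ k ℕ.<_) (sym kl) (ℕ.n<1+n _))) l≤c)
... | above k≤c eq₁ | below c<l eq₂ = begin
  A (suc r) (punchIn k c)
    ≡⟨ cong (A (suc r)) (Fin.toℕ-injective (trans eq₁ (trans (cong suc c≡k) (sym kl)))) ⟩
  A (suc r) l
    ≡⟨ Aₖ≡Aₗ (suc r) ⟨
  A (suc r) k
    ≡⟨ cong (A (suc r)) (Fin.toℕ-injective (trans (sym c≡k) (sym eq₂))) ⟩
  A (suc r) (punchIn l c) ∎
  where
  c≡k : toℕ c ≡ toℕ k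
  c≡k = ℕ.≤-antisym (ℕ.s≤s⁻¹ (subst (suc (toℕ c) ℕ.≤_) kl c<l)) k≤c

punchOut-adjacent : ∀ {m} {j k l : Fin (suc m)} (j≢k : j ≢ k) (j≢l : j ≢ l) →
  AdjacentColumns k l → AdjacentColumns (punchOut j≢k) (punchOut j≢l)
punchOut-adjacent {j = j} j≢k j≢l kl
  with punchInView j (punchOut j≢k) | punchInView j (punchOut j≢l)
... | below _ eq₁ | below _ eq₂ = trans (sym eq₂) (trans l≡ (cong suc (trans (sym k≡) eq₁)))
  where
  k≡ = cong toℕ (Fin.punchIn-punchOut j≢k)
  l≡ = trans (cong toℕ (Fin.punchIn-punchOut j≢l)) kl
... | above _ eq₁ | above _ eq₂ = ℕ.suc-injective (trans (sym eq₂) (trans l≡ (cong suc (trans (sym k≡) eq₁))))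
  where
  k≡ = cong toℕ (Fin.punchIn-punchOut j≢k)
  l≡ = trans (cong toℕ (Fin.punchIn-punchOut j≢l)) kl
... | below k′<j eq₁ | above j≤l′ eq₂ = ⊥-elim (ℕ.<⇒≱ k′<j (subst (toℕ j ℕ.≤_) l′≡k′ j≤l′))
  where
  l′≡k′ = ℕ.suc-injective (trans (sym eq₂) (trans (cong toℕ (Fin.punchIn-punchOut j≢l))
            (trans kl (cong suc (trans (sym (cong toℕ (Fin.punchIn-punchOut j≢k))) eq₁)))))
... | above j≤k′ eq₁ | below l′<j eq₂ =
  ⊥-elim (ℕ.<⇒≱ (ℕ.<-≤-trans l′<j j≤k′) (ℕ.≤-trans (ℕ.n≤1+n _) (ℕ.≤-trans (ℕ.n≤1+n _) (ℕ.≤-reflexive (sym l′≡)))))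
  where
  l′≡ = trans (sym eq₂) (trans (cong toℕ (Fin.punchIn-punchOut j≢l))
          (trans kl (cong suc (trans (sym (cong toℕ (Fin.punchIn-punchOut j≢k))) eq₁))))

det-adjacent-equal : ∀ {m} (A : Matrix m) {k l} → AdjacentColumns k l → (∀ r → A r k ≡ A r l) → det A ≡ + 0
det-adjacent-equal {suc m} A {k} {l} kl Aₖ≡Aₗ =
  trans (det-expand A) (sum-pair (cofactorTerm A) (adjacent⇒≢ kl) cancel rest)
  where
  cancel : cofactorTerm A k + cofactorTerm A l ≡ + 0
  cancel = begin
    sign (toℕ k) * (A zero k * det (minor A k)) + sign (toℕ l) * (A zero l * det (minor A l))
      ≡⟨ cong₂ (λ σ a → sign (toℕ k) * (A zero k * det (minor A k)) + σ * (a * det (minor A l)))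
               (cong sign kl) (sym (Aₖ≡Aₗ zero)) ⟩
    sign (toℕ k) * (A zero k * det (minor A k)) + - sign (toℕ k) * (A zero k * det (minor A l))
      ≡⟨ cong (λ d → sign (toℕ k) * (A zero k * det (minor A k)) + - sign (toℕ k) * (A zero k * d))
              (det-cong (minor-adjacent A kl Aₖ≡Aₗ)) ⟨
    sign (toℕ k) * (A zero k * det (minor A k)) + - sign (toℕ k) * (A zero k * det (minor A k))
      ≡⟨ opposite (sign (toℕ k)) (A zero k * det (minor A k)) ⟩
    + 0 ∎
    where
    opposite : ∀ σ t → σ * t + - σ * t ≡ + 0
    opposite = solve-∀
  rest : ∀ j → j ≢ k → j ≢ l → cofactorTerm A j ≡ + 0
  rest j j≢k j≢l = cofactorTerm-zero A j (det-adjacent-equal (minor A j) (punchOut-adjacent j≢k j≢l kl)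
    λ r → trans (minor-column A j≢k r) (trans (Aₖ≡Aₗ (suc r)) (sym (minor-column A j≢l r))))

setColumn : ∀ {m} → Matrix m → Fin m → (Fin m → ℤ) → Matrix m
setColumn A k v r c with c Fin.≟ k
... | yes _ = v r
... | no  _ = A r c

setColumn-at : ∀ {m} (A : Matrix m) k v r → setColumn A k v r k ≡ v r
setColumn-at A k v r with k Fin.≟ k
... | yes _   = refl
... | no  k≢k = ⊥-elim (k≢k refl)

setColumn-off : ∀ {m} (A : Matrix m) k v → AgreeOffColumn k (setColumn A k v) A
setColumn-off A k v r c c≢k with c Fin.≟ k
... | yes c≡k = ⊥-elim (c≢k c≡k)
... | no  _   = refl

withColumns : ∀ {m} → Matrix m → Fin m → Fin m → (Fin m → ℤ) → (Fin m → ℤ) → Matrix m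
withColumns A k l u v = setColumn (setColumn A k u) l v

withColumns-first : ∀ {m} (A : Matrix m) k l u v → k ≢ l → ∀ r → withColumns A k l u v r k ≡ u r
withColumns-first A k l u v k≢l r = trans (setColumn-off _ l v r k k≢l) (setColumn-at A k u r)

withColumns-second : ∀ {m} (A : Matrix m) k l u v r → withColumns A k l u v r l ≡ v r
withColumns-second A k l u v r = setColumn-at _ l v r

withColumns-rest : ∀ {m} (A : Matrix m) k l u v r c → c ≢ k → c ≢ l → withColumns A k l u v r c ≡ A r c
withColumns-rest A k l u v r c c≢k c≢l = trans (setColumn-off _ l v r c c≢l) (setColumn-off A k u r c c≢k)

withColumns-agree-first : ∀ {m} (A : Matrix m) k l u u′ v →
  AgreeOffColumn k (withColumns A k l u v) (withColumns A k l u′ v)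
withColumns-agree-first A k l u u′ v r c c≢k = byCases (c Fin.≟ l)
  where
  byCases : Dec (c ≡ l) → withColumns A k l u v r c ≡ withColumns A k l u′ v r c
  byCases (yes refl) = trans (withColumns-second A k l u v r) (sym (withColumns-second A k l u′ v r))
  byCases (no  c≢l)  = trans (withColumns-rest A k l u v r c c≢k c≢l) (sym (withColumns-rest A k l u′ v r c c≢k c≢l))

withColumns-agree-second : ∀ {m} (A : Matrix m) k l u v v′ →
  AgreeOffColumn l (withColumns A k l u v) (withColumns A k l u v′)
withColumns-agree-second A k l u v v′ r c c≢l = trans (setColumn-off _ l v r c c≢l) (sym (setColumn-off _ l v′ r c c≢l))

-- D u v = det (withColumns A k l u v) is additive in u and v and vanishes for u = v, so
-- D a b + D b a ≡ D (a + b) (a + b) ≡ 0.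
det-swap-adjacent : ∀ {m} {A B : Matrix m} {k l} → AdjacentColumns k l →
  (∀ r → B r k ≡ A r l) → (∀ r → B r l ≡ A r k) → (∀ r c → c ≢ k → c ≢ l → B r c ≡ A r c) →
  det B ≡ - det A
det-swap-adjacent {A = A} {B} {k} {l} kl Bₖ Bₗ B≡A =
  inverseʳ-unique (det A) (det B) (trans (sym expansion) (vanish s))
  where
  k≢l = adjacent⇒≢ kl
  X = withColumns A k l
  a b s : Fin _ → ℤ
  a r = A r k
  b r = A r l
  s r = a r + b r
  vanish : ∀ u → det (X u u) ≡ + 0
  vanish u = det-adjacent-equal (X u u) kl λ r → trans (withColumns-first A k l u u k≢l r) (sym (withColumns-second A k l u u r))
  additive-first : ∀ v → det (X s v) ≡ det (X a v) + det (X b v)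
  additive-first v = det-additive k (withColumns-agree-first A k l a s v) (withColumns-agree-first A k l b s v) λ r →
    trans (withColumns-first A k l s v k≢l r)
          (sym (cong₂ _+_ (withColumns-first A k l a v k≢l r) (withColumns-first A k l b v k≢l r)))
  additive-second : ∀ u → det (X u s) ≡ det (X u a) + det (X u b)
  additive-second u = det-additive l (withColumns-agree-second A k l u a s) (withColumns-agree-second A k l u b s) λ r →
    trans (withColumns-second A k l u s r) (sym (cong₂ _+_ (withColumns-second A k l u a r) (withColumns-second A k l u b r)))
  X≡A : ∀ r c → X a b r c ≡ A r c
  X≡A r c = byCases (c Fin.≟ k) (c Fin.≟ l)
    where
    byCases : Dec (c ≡ k) → Dec (c ≡ l) → X a b r c ≡ A r c
    byCases (yes refl) _          = withColumns-first A k l a b k≢l r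
    byCases (no  _)    (yes refl) = withColumns-second A k l a b r
    byCases (no  c≢k)  (no  c≢l)  = withColumns-rest A k l a b r c c≢k c≢l
  X≡B : ∀ r c → X b a r c ≡ B r c
  X≡B r c = byCases (c Fin.≟ k) (c Fin.≟ l)
    where
    byCases : Dec (c ≡ k) → Dec (c ≡ l) → X b a r c ≡ B r c
    byCases (yes refl) _          = trans (withColumns-first A k l b a k≢l r) (sym (Bₖ r))
    byCases (no  _)    (yes refl) = trans (withColumns-second A k l b a r) (sym (Bₗ r))
    byCases (no  c≢k)  (no  c≢l)  = trans (withColumns-rest A k l b a r c c≢k c≢l) (sym (B≡A r c c≢k c≢l))
  expansion : det (X s s) ≡ det A + det B
  expansion = begin
    det (X s s)
      ≡⟨ additive-first s ⟩
    det (X a s) + det (X b s)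
      ≡⟨ cong₂ _+_ (additive-second a) (additive-second b) ⟩
    (det (X a a) + det (X a b)) + (det (X b a) + det (X b b))
      ≡⟨ cong₂ (λ p q → (p + det (X a b)) + (det (X b a) + q))
          (vanish a) (vanish b) ⟩
    (+ 0 + det (X a b)) + (det (X b a) + + 0)
      ≡⟨ cong₂ _+_ (ℤ.+-identityˡ (det (X a b))) (ℤ.+-identityʳ (det (X b a))) ⟩
    det (X a b) + det (X b a)
      ≡⟨ cong₂ _+_ (det-cong X≡A) (det-cong X≡B) ⟩
    det A + det B ∎

det-equal-columns-at-distance : ∀ d {m} (A : Matrix m) {k l} → toℕ l ≡ suc (d ℕ.+ toℕ k) →
  (∀ r → A r k ≡ A r l) → det A ≡ + 0
det-equal-columns-at-distance zero    A kl Aₖ≡Aₗ = det-adjacent-equal A kl Aₖ≡Aₗ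
det-equal-columns-at-distance (suc d) {m} A {k} {l} kl Aₖ≡Aₗ = begin
  det A
    ≡⟨ ℤ.neg-involutive (det A) ⟨
  - - det A
    ≡⟨ cong -_ (det-swap-adjacent l⁻l Bₗ₋ Bₗ B-rest) ⟨
  - det B
    ≡⟨ cong -_ (det-equal-columns-at-distance d B (Fin.toℕ-fromℕ< l⁻<m) Bₖ≡Bₗ₋) ⟩
  - + 0 ∎
  where
  -- swap column l with its left neighbour l⁻, which lies at distance d from k
  l⁻<m : suc (d ℕ.+ toℕ k) ℕ.< m
  l⁻<m = ℕ.<-trans (ℕ.n<1+n _) (subst (ℕ._< m) kl (Fin.toℕ<n l))
  l⁻ : Fin m
  l⁻ = fromℕ< l⁻<m
  l⁻l : AdjacentColumns l⁻ l
  l⁻l = trans kl (cong suc (sym (Fin.toℕ-fromℕ< l⁻<m)))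
  B : Matrix m
  B = withColumns A l⁻ l (λ r → A r l) (λ r → A r l⁻)
  Bₗ₋ : ∀ r → B r l⁻ ≡ A r l
  Bₗ₋ = withColumns-first A l⁻ l _ _ (adjacent⇒≢ l⁻l)
  Bₗ : ∀ r → B r l ≡ A r l⁻
  Bₗ = withColumns-second A l⁻ l _ _
  B-rest : ∀ r c → c ≢ l⁻ → c ≢ l → B r c ≡ A r c
  B-rest = withColumns-rest A l⁻ l _ _
  k≢l⁻ : k ≢ l⁻
  k≢l⁻ eq = ℕ.m≢1+m+n (toℕ k) (trans (cong toℕ eq) (trans (Fin.toℕ-fromℕ< l⁻<m) (cong suc (ℕ.+-comm d (toℕ k)))))
  k≢l : k ≢ l
  k≢l eq = ℕ.m≢1+m+n (toℕ k) (trans (cong toℕ eq) (trans kl (cong suc (ℕ.+-comm (suc d) (toℕ k)))))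
  Bₖ≡Bₗ₋ : ∀ r → B r k ≡ B r l⁻
  Bₖ≡Bₗ₋ r = trans (B-rest r k k≢l⁻ k≢l) (trans (Aₖ≡Aₗ r) (sym (Bₗ₋ r)))

det-equal-columns-< : ∀ {m} (A : Matrix m) {k l} → toℕ k ℕ.< toℕ l → (∀ r → A r k ≡ A r l) → det A ≡ + 0
det-equal-columns-< A {k} {l} k<l = det-equal-columns-at-distance (toℕ l ℕ.∸ suc (toℕ k)) A
  (trans (sym (ℕ.m∸n+n≡m k<l)) (ℕ.+-suc (toℕ l ℕ.∸ suc (toℕ k)) (toℕ k)))

det-equal-columns : ∀ {m} (A : Matrix m) {k l} → k ≢ l → (∀ r → A r k ≡ A r l) → det A ≡ + 0
det-equal-columns A {k} {l} k≢l Aₖ≡Aₗ with ℕ.<-cmp (toℕ k) (toℕ l)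
... | tri< k<l _ _ = det-equal-columns-< A k<l Aₖ≡Aₗ
... | tri≈ _ k≡l _ = ⊥-elim (k≢l (Fin.toℕ-injective k≡l))
... | tri> _ _ l<k = det-equal-columns-< A l<k (λ r → sym (Aₖ≡Aₗ r))

det-add-columns : ∀ p {m} {A C : Matrix m} k (g : Fin p → Fin m → ℤ) → AgreeOffColumn k A C →
  (∀ r → C r k ≡ A r k + sum (λ i → g i r)) →
  det C ≡ det A + sum (λ i → det (setColumn A k (g i)))
det-add-columns zero {A = A} {C} k g A~C Cₖ = trans (det-cong C≡A) (sym (ℤ.+-identityʳ (det A)))
  where
  C≡A : ∀ r c → C r c ≡ A r c
  C≡A r c with c Fin.≟ k
  ... | yes refl = trans (Cₖ r) (ℤ.+-identityʳ (A r c))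
  ... | no  c≢k  = sym (A~C r c c≢k)
det-add-columns (suc p) {A = A} {C} k g A~C Cₖ = begin
  det C
    ≡⟨ det-additive k (agree _) (agree _) Cₖ′ ⟩
  det A′ + det Aᵍ
    ≡⟨ cong (_+ det Aᵍ) (det-add-columns p k (g ∘ suc) (λ r c c≢k → sym (setColumn-off A k _ r c c≢k))
                                                          (setColumn-at A k _)) ⟩
  det A + sum (λ i → det (setColumn A k (g (suc i)))) + det Aᵍ
    ≡⟨ regroup (det A) _ (det Aᵍ) ⟩
  det A + (det Aᵍ + sum (λ i → det (setColumn A k (g (suc i))))) ∎
  where
  regroup : ∀ a s d → a + s + d ≡ a + (d + s)
  regroup = solve-∀
  A′ Aᵍ : Matrix _
  A′ = setColumn A k (λ r → A r k + sum (λ i → g (suc i) r))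
  Aᵍ = setColumn A k (g zero)
  agree : ∀ v → AgreeOffColumn k (setColumn A k v) C
  agree v r c c≢k = trans (setColumn-off A k v r c c≢k) (A~C r c c≢k)
  swap : ∀ a b s → a + (b + s) ≡ (a + s) + b
  swap = solve-∀
  Cₖ′ : ∀ r → C r k ≡ A′ r k + Aᵍ r k
  Cₖ′ r = trans (Cₖ r) (trans (swap (A r k) (g zero r) _)
            (sym (cong₂ _+_ (setColumn-at A k _ r) (setColumn-at A k _ r))))

det-add-column-combination : ∀ {m} {A C : Matrix m} k (w : Fin m → ℤ) → w k ≡ + 0 →
  AgreeOffColumn k A C → (∀ r → C r k ≡ A r k + sum (λ l → w l * A r l)) → det C ≡ det A
det-add-column-combination {m} {A} {C} k w wₖ≡0 A~C Cₖ = begin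
  det C
    ≡⟨ det-add-columns m k (λ l r → w l * A r l) A~C Cₖ ⟩
  det A + sum (λ l → det (setColumn A k (λ r → w l * A r l)))
    ≡⟨ cong (_+_ (det A)) (sum-zero vanish) ⟩
  det A + + 0
    ≡⟨ ℤ.+-identityʳ (det A) ⟩
  det A ∎
  where
  copy : Fin m → Matrix m
  copy l = setColumn A k (λ r → A r l)
  vanish : ∀ l → det (setColumn A k (λ r → w l * A r l)) ≡ + 0
  vanish l = trans (det-scale-column k (w l) {copy l}
                      (λ r c c≢k → trans (setColumn-off A k _ r c c≢k) (sym (setColumn-off A k _ r c c≢k)))
                      (λ r → trans (setColumn-at A k _ r) (cong (w l *_) (sym (setColumn-at A k _ r)))))
                   (byCases (l Fin.≟ k))
    where
    byCases : Dec (l ≡ k) → w l * det (copy l) ≡ + 0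
    byCases (yes refl) = trans (cong (_* det (copy l)) wₖ≡0) (ℤ.*-zeroˡ (det (copy l)))
    byCases (no  l≢k)  = trans (cong (w l *_) (det-equal-columns (copy l) (l≢k ∘ sym)
                           λ r → trans (setColumn-at A k _ r) (sym (setColumn-off A k _ r l l≢k))))
                         (ℤ.*-zeroʳ (w l))

mergeColumns : ∀ {m} → ℕ → Matrix m → Matrix m → Matrix m
mergeColumns t C A r c with toℕ c ℕ.<? t
... | yes _ = C r c
... | no  _ = A r c

mergeColumns-< : ∀ {m} t (C A : Matrix m) r c → toℕ c ℕ.< t → mergeColumns t C A r c ≡ C r c
mergeColumns-< t C A r c c<t with toℕ c ℕ.<? t
... | yes _   = refl
... | no  c≮t = ⊥-elim (c≮t c<t)

mergeColumns-≮ : ∀ {m} t (C A : Matrix m) r c → ¬ toℕ c ℕ.< t → mergeColumns t C A r c ≡ A r c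
mergeColumns-≮ t C A r c c≮t with toℕ c ℕ.<? t
... | yes c<t = ⊥-elim (c≮t c<t)
... | no  _   = refl

-- Columns are updated one at a time; sources are never updated, so the columns added to a
-- target still hold their original entries.
det-simultaneous-column-operations : ∀ {m} {A C : Matrix m} (W : Fin m → Fin m → ℤ) (source : Fin m → Bool) →
  (∀ l c → source l ≡ false → W l c ≡ + 0) → (∀ l c → source c ≡ true → W l c ≡ + 0) →
  (∀ r c → C r c ≡ A r c + sum (λ l → W l c * A r l)) → det C ≡ det A
det-simultaneous-column-operations {m} {A} {C} W source W-source W-target C≡ =
  trans (det-cong (λ r c → sym (mergeColumns-< m C A r c (Fin.toℕ<n c)))) (partial m ℕ.≤-refl)
  where
  M : ℕ → Matrix m
  M t = mergeColumns t C A
  unchanged : ∀ r l → source l ≡ true → C r l ≡ A r l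
  unchanged r l l-source = begin
    C r l
      ≡⟨ C≡ r l ⟩
    A r l + sum (λ l′ → W l′ l * A r l′)
      ≡⟨ cong (_+_ (A r l)) (sum-zero λ l′ →
          trans (cong (_* A r l′) (W-target l′ l l-source)) (ℤ.*-zeroˡ (A r l′))) ⟩
    A r l + + 0
      ≡⟨ ℤ.+-identityʳ (A r l) ⟩
    A r l ∎
  W-diagonal : ∀ k → W k k ≡ + 0
  W-diagonal k with source k in eq
  ... | false = W-source k k eq
  ... | true  = W-target k k eq
  W*M : ∀ t r l k → W l k * M t r l ≡ W l k * A r l
  W*M t r l k with source l in eq
  ... | false = trans (cong (_* M t r l) (W-source l k eq))
                  (trans (ℤ.*-zeroˡ (M t r l)) (sym (trans (cong (_* A r l) (W-source l k eq)) (ℤ.*-zeroˡ (A r l)))))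
  ... | true  = cong (W l k *_) (byCases (toℕ l ℕ.<? t))
    where
    byCases : Dec (toℕ l ℕ.< t) → M t r l ≡ A r l
    byCases (yes l<t) = trans (mergeColumns-< t C A r l l<t) (unchanged r l eq)
    byCases (no  l≮t) = mergeColumns-≮ t C A r l l≮t
  partial : ∀ t → t ℕ.≤ m → det (M t) ≡ det A
  partial zero    _   = det-cong (λ r c → mergeColumns-≮ zero C A r c λ ())
  partial (suc t) t<m =
    trans (det-add-column-combination k (λ l → W l k) (W-diagonal k) agree column) (partial t (ℕ.<⇒≤ t<m))
    where
    k : Fin m
    k = fromℕ< t<m
    k≡t : toℕ k ≡ t
    k≡t = Fin.toℕ-fromℕ< t<m
    agree : AgreeOffColumn k (M t) (M (suc t))
    agree r c c≢k = byCases (toℕ c ℕ.<? t)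
      where
      byCases : Dec (toℕ c ℕ.< t) → M t r c ≡ M (suc t) r c
      byCases (yes c<t) = trans (mergeColumns-< t C A r c c<t) (sym (mergeColumns-< (suc t) C A r c (ℕ.m<n⇒m<1+n c<t)))
      byCases (no  c≮t) = trans (mergeColumns-≮ t C A r c c≮t) (sym (mergeColumns-≮ (suc t) C A r c λ c<1+t →
        c≢k (Fin.toℕ-injective (trans (ℕ.≤-antisym (ℕ.s≤s⁻¹ c<1+t) (ℕ.≮⇒≥ c≮t)) (sym k≡t)))))
    column : ∀ r → M (suc t) r k ≡ M t r k + sum (λ l → W l k * M t r l)
    column r = begin
      M (suc t) r k
        ≡⟨ mergeColumns-< (suc t) C A r k (subst (ℕ._< suc t) (sym k≡t) (ℕ.n<1+n t)) ⟩
      C r k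
        ≡⟨ C≡ r k ⟩
      A r k + sum (λ l → W l k * A r l)
        ≡⟨ cong₂ _+_ (mergeColumns-≮ t C A r k (ℕ.<-irrefl k≡t)) (sum-cong-≗ (λ l → W*M t r l k)) ⟨
      M t r k + sum (λ l → W l k * M t r l) ∎

-- Kinds of vertices

-- ε is the identity, ρ₁ = a, ρ any other non-trivial rotation, τ₀ = b and τ any other reflection.
data Kind : Set where
  ε          : Kind
  rotation   : (first : Bool) → Kind
  reflection : (first : Bool) → Kind

pattern ρ₁ = rotation true
pattern ρ  = rotation false
pattern τ₀ = reflection true
pattern τ  = reflection false

adjacent : Kind → Kind → Bool
adjacent ε              _              = true
adjacent _              ε              = true
adjacent (rotation _)   (rotation _)   = true
adjacent (reflection _) (reflection _) = true
adjacent (rotation _)   (reflection _) = false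
adjacent (reflection _) (rotation _)   = false

data Position : Set where
  diagonal    : Kind → Position
  offDiagonal : (row column : Kind) → Position

-- Distinct vertices never share a kind that has a single member.
occurs : Position → Bool
occurs (offDiagonal ε  ε)  = false
occurs (offDiagonal ρ₁ ρ₁) = false
occurs (offDiagonal τ₀ τ₀) = false
occurs _                   = true

rowKind columnKind : Position → Kind
rowKind (diagonal k)          = k
rowKind (offDiagonal k _)     = k
columnKind (diagonal k)       = k
columnKind (offDiagonal _ k′) = k′

kinds : List Kind
kinds = ε ∷ ρ₁ ∷ ρ ∷ τ₀ ∷ τ ∷ []

∈-kinds : ∀ k → k ∈ kinds
∈-kinds ε  = here refl
∈-kinds ρ₁ = there (here refl)
∈-kinds ρ  = there (there (here refl))
∈-kinds τ₀ = there (there (there (here refl)))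
∈-kinds τ  = there (there (there (there (here refl))))

allKinds : (Kind → Bool) → Bool
allKinds P = all P kinds

allKinds-sound : ∀ P → T (allKinds P) → ∀ k → T (P k)
allKinds-sound P holds k = All.lookup (all⁺ P kinds holds) (∈-kinds k)

allPositions : (Position → Bool) → Bool
allPositions P = allKinds (λ k → P (diagonal k)) ∧ allKinds (λ k → allKinds (λ k′ → P (offDiagonal k k′)))

allPositions-sound : ∀ P → T (allPositions P) → ∀ p → T (P p)
allPositions-sound P holds with Equivalence.to (T-∧ {allKinds (P ∘ diagonal)}) holds
... | on-diagonal , off-diagonal = λ where
  (diagonal k)       → allKinds-sound (P ∘ diagonal) on-diagonal k
  (offDiagonal k k′) → allKinds-sound (P ∘ offDiagonal k)
                         (allKinds-sound (λ k → allKinds (P ∘ offDiagonal k)) off-diagonal k) k′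

module Vertices (d : ℕ) where

  N : ℕ
  N = suc (suc (suc d))

  open Dihedral N
  open DihedralProperties N

  isZero : ∀ {m} → Fin m → Bool
  isZero zero    = true
  isZero (suc _) = false

  rotationKind reflectionKind : Fin N → Kind
  rotationKind zero    = ε
  rotationKind (suc i) = rotation (isZero i)
  reflectionKind j     = reflection (isZero j)

  -- Vertex t is a^t for t < N and a^(t - N) b otherwise.
  kind : Fin (N ℕ.+ N) → Kind
  kind t = [ rotationKind , reflectionKind ]′ (splitAt N t)

  rotationIndex reflectionIndex : Fin N → Fin (N ℕ.+ N)
  rotationIndex i   = i ↑ˡ N
  reflectionIndex j = N ↑ʳ j

  kind-rotation : ∀ i → kind (rotationIndex i) ≡ rotationKind i
  kind-rotation i = cong [ rotationKind , reflectionKind ]′ (Fin.splitAt-↑ˡ N i N)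

  kind-reflection : ∀ j → kind (reflectionIndex j) ≡ reflectionKind j
  kind-reflection j = cong [ rotationKind , reflectionKind ]′ (Fin.splitAt-↑ʳ N N j)

  elem-rotation : ∀ i → elem (rotationIndex i) ≡ (i , false)
  elem-rotation i rewrite Fin.splitAt-↑ˡ N i N = refl

  elem-reflection : ∀ j → elem (reflectionIndex j) ≡ (j , true)
  elem-reflection j rewrite Fin.splitAt-↑ʳ N N j = refl

  data IndexView : Fin (N ℕ.+ N) → Set where
    rotationᵛ   : ∀ i → IndexView (rotationIndex i)
    reflectionᵛ : ∀ j → IndexView (reflectionIndex j)

  indexView : ∀ t → IndexView t
  indexView t with splitAt N t in eq
  ... | inj₁ i = subst IndexView (Fin.splitAt⁻¹-↑ˡ {m = N} {n = N} eq) (rotationᵛ i)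
  ... | inj₂ j = subst IndexView (Fin.splitAt⁻¹-↑ʳ {m = N} {n = N} eq) (reflectionᵛ j)

  KindRange : Kind → ℕ → Set
  KindRange ε  t = t ≡ 0
  KindRange ρ₁ t = t ≡ 1
  KindRange ρ  t = 2 ℕ.≤ t × t ℕ.< N
  KindRange τ₀ t = t ≡ N
  KindRange τ  t = N ℕ.< t

  kind-range : ∀ t → KindRange (kind t) (toℕ t)
  kind-range t with indexView t
  ... | rotationᵛ i rewrite kind-rotation i | Fin.toℕ-↑ˡ i N = rotation-range i
    where
    rotation-range : ∀ i → KindRange (rotationKind i) (toℕ i)
    rotation-range zero          = refl
    rotation-range (suc zero)    = refl
    rotation-range (suc (suc i)) = s≤s (s≤s z≤n) , Fin.toℕ<n (suc (suc i))
  ... | reflectionᵛ j rewrite kind-reflection j | Fin.toℕ-↑ʳ N j = reflection-range j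
    where
    reflection-range : ∀ j → KindRange (reflectionKind j) (N ℕ.+ toℕ j)
    reflection-range zero    = ℕ.+-identityʳ N
    reflection-range (suc j) = ℕ.m<m+n N (s≤s z≤n)

  elem-injective : ∀ s t → elem s ≡ elem t → s ≡ t
  elem-injective s t eq with indexView s | indexView t
  ... | rotationᵛ i   | rotationᵛ j   = cong rotationIndex (cong proj₁ (trans (sym (elem-rotation i)) (trans eq (elem-rotation j))))
  ... | reflectionᵛ i | reflectionᵛ j =
    cong reflectionIndex (cong proj₁ (trans (sym (elem-reflection i)) (trans eq (elem-reflection j))))
  ... | rotationᵛ i   | reflectionᵛ j =
    contradiction (cong proj₂ (trans (sym (elem-rotation i)) (trans eq (elem-reflection j)))) λ ()
  ... | reflectionᵛ i | rotationᵛ j   =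
    contradiction (cong proj₂ (trans (sym (elem-reflection i)) (trans eq (elem-rotation j)))) λ ()

  linked-reflects : ∀ h → N ≡ suc (2 ℕ.* h) →
    ∀ s t → Reflects (Linked (elem s) (elem t)) (adjacent (kind s) (kind t))
  linked-reflects h N≡2h+1 s t with indexView s | indexView t
  ... | rotationᵛ i | rotationᵛ j rewrite elem-rotation i | elem-rotation j | kind-rotation i | kind-rotation j = rotations i j
    where
    rotations : ∀ i j → Reflects (Linked (i , false) (j , false)) (adjacent (rotationKind i) (rotationKind j))
    rotations zero    j       = ofʸ (linked-rotations zero j)
    rotations (suc i) zero    = ofʸ (linked-rotations (suc i) zero)
    rotations (suc i) (suc j) = ofʸ (linked-rotations (suc i) (suc j))
  ... | rotationᵛ i | reflectionᵛ j rewrite elem-rotation i | elem-reflection j | kind-rotation i | kind-reflection j = mixed i j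
    where
    mixed : ∀ i j → Reflects (Linked (i , false) (j , true)) (adjacent (rotationKind i) (reflectionKind j))
    mixed zero    j = ofʸ (linked-identity-reflection zero j refl)
    mixed (suc i) j = ofⁿ (unlinked-rotation-reflection (suc i) j λ ())
  ... | reflectionᵛ i | rotationᵛ j rewrite elem-reflection i | elem-rotation j | kind-reflection i | kind-rotation j = mixed i j
    where
    mixed : ∀ i j → Reflects (Linked (i , true) (j , false)) (adjacent (reflectionKind i) (rotationKind j))
    mixed i zero    = ofʸ (linked-sym (linked-identity-reflection zero i refl))
    mixed i (suc j) = ofⁿ (unlinked-rotation-reflection (suc j) i (λ ()) ∘ linked-sym)
  ... | reflectionᵛ i | reflectionᵛ j rewrite elem-reflection i | elem-reflection j | kind-reflection i | kind-reflection j =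
    ofʸ (linked-reflections h N≡2h+1 i j)

  ∑ᵏ : (Kind → ℤ) → ℤ
  ∑ᵏ g = g ε + (g ρ₁ + (+ suc d * g ρ + (g τ₀ + + suc (suc d) * g τ)))

  sum-by-kind : ∀ (g : Kind → ℤ) → sum (g ∘ kind) ≡ ∑ᵏ g
  sum-by-kind g = begin
    sum (g ∘ kind)
      ≡⟨ sum-splitAt N {N} (g ∘ kind) ⟩
    sum (g ∘ kind ∘ rotationIndex) + sum (g ∘ kind ∘ reflectionIndex)
      ≡⟨ cong₂ _+_ (sum-cong-≗ (cong g ∘ kind-rotation)) (sum-cong-≗ (cong g ∘ kind-reflection)) ⟩
    sum (g ∘ rotationKind) + sum (g ∘ reflectionKind)
      ≡⟨ cong₂ (λ a b → (g ε + (g ρ₁ + a)) + (g τ₀ + b))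
               (sum-const (suc d) (g ρ)) (sum-const (suc (suc d)) (g τ)) ⟩
    (g ε + (g ρ₁ + + suc d * g ρ)) + (g τ₀ + + suc (suc d) * g τ)
      ≡⟨ regroup (g ε) (g ρ₁) (+ suc d * g ρ) (g τ₀) _ ⟩
    ∑ᵏ g ∎
    where
    regroup : ∀ a b c e f → (a + (b + c)) + (e + f) ≡ a + (b + (c + (e + f)))
    regroup = solve-∀

  ∏ᵏ : (Kind → ℤ) → ℤ
  ∏ᵏ g = (g ε * (g ρ₁ * g ρ ℤ.^ suc d)) * (g τ₀ * g τ ℤ.^ suc (suc d))

  product-by-kind : ∀ (g : Kind → ℤ) → product (g ∘ kind) ≡ ∏ᵏ g
  product-by-kind g = begin
    product (g ∘ kind)
      ≡⟨ product-splitAt N {N} (g ∘ kind) ⟩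
    product (g ∘ kind ∘ rotationIndex) * product (g ∘ kind ∘ reflectionIndex)
      ≡⟨ cong₂ _*_ (product-cong-≗ (cong g ∘ kind-rotation)) (product-cong-≗ (cong g ∘ kind-reflection)) ⟩
    product (g ∘ rotationKind) * product (g ∘ reflectionKind)
      ≡⟨ cong₂ (λ a b → (g ε * (g ρ₁ * a)) * (g τ₀ * b))
               (product-const (suc d) (g ρ)) (product-const (suc (suc d)) (g τ)) ⟩
    ∏ᵏ g ∎

  position : Fin (N ℕ.+ N) → Fin (N ℕ.+ N) → Position
  position r c with r Fin.≟ c
  ... | yes _ = diagonal (kind r)
  ... | no  _ = offDiagonal (kind r) (kind c)

  position-diagonal : ∀ r → position r r ≡ diagonal (kind r)
  position-diagonal r with r Fin.≟ r
  ... | yes _   = refl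
  ... | no  r≢r = ⊥-elim (r≢r refl)

  position-offDiagonal : ∀ {r c} → r ≢ c → position r c ≡ offDiagonal (kind r) (kind c)
  position-offDiagonal {r} {c} r≢c with r Fin.≟ c
  ... | yes r≡c = ⊥-elim (r≢c r≡c)
  ... | no  _   = refl

  rowKind-position : ∀ r c → rowKind (position r c) ≡ kind r
  rowKind-position r c with r Fin.≟ c
  ... | yes _ = refl
  ... | no  _ = refl

  columnKind-position : ∀ r c → columnKind (position r c) ≡ kind c
  columnKind-position r c with r Fin.≟ c
  ... | yes refl = refl
  ... | no  _    = refl

  position-occurs : ∀ r c → T (occurs (position r c))
  position-occurs r c with r Fin.≟ c
  ... | yes _   = tt
  ... | no  r≢c = distinct (kind r) (kind c) (kind-range r) (kind-range c)
    where
    distinct : ∀ k k′ → KindRange k (toℕ r) → KindRange k′ (toℕ c) → T (occurs (offDiagonal k k′))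
    distinct ε              ε              r≡0 c≡0 = ⊥-elim (r≢c (Fin.toℕ-injective (trans r≡0 (sym c≡0))))
    distinct ε              (rotation _)   _   _   = tt
    distinct ε              (reflection _) _   _   = tt
    distinct ρ₁             ρ₁             r≡1 c≡1 = ⊥-elim (r≢c (Fin.toℕ-injective (trans r≡1 (sym c≡1))))
    distinct ρ₁             ρ              _   _   = tt
    distinct ρ₁             ε              _   _   = tt
    distinct ρ₁             (reflection _) _   _   = tt
    distinct ρ              _              _   _   = tt
    distinct τ₀             τ₀             r≡N c≡N = ⊥-elim (r≢c (Fin.toℕ-injective (trans r≡N (sym c≡N))))
    distinct τ₀             τ              _   _   = tt
    distinct τ₀             ε              _   _   = tt
    distinct τ₀             (rotation _)   _   _   = tt
    distinct τ              _              _   _   = tt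

  -- Row r is summed kind by kind as if all its entries were off-diagonal, then corrected at column r.
  rowSumᶻ : (Kind → Position → ℤ) → Kind → ℤ
  rowSumᶻ H k = ∑ᵏ (λ k′ → H k′ (offDiagonal k k′)) + (H k (diagonal k) - H k (offDiagonal k k))

  sum-row : ∀ (H : Kind → Position → ℤ) r → sum (λ l → H (kind l) (position r l)) ≡ rowSumᶻ H (kind r)
  sum-row H r = begin
    sum (λ l → H (kind l) (position r l))
      ≡⟨ sum-update _ _ r (λ l l≢r → cong (H (kind l)) (position-offDiagonal (l≢r ∘ sym))) ⟩
    sum (g ∘ kind) + (H (kind r) (position r r) - g (kind r))
      ≡⟨ cong₂ (λ s p → s + (H (kind r) p - g (kind r))) (sum-by-kind g) (position-diagonal r) ⟩
    rowSumᶻ H (kind r) ∎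
    where
    g : Kind → ℤ
    g k = H k (offDiagonal (kind r) k)

-- Reduction of xI - L by column operations on kinds

module Reduction (d : ℕ) (x : ℤ) where

  open Vertices d
  open +-*-Solver using (Polynomial; con; var; _:+_; _:*_; _:-_; :-_; ⟦_⟧; normalise; _≟N_; ⟦_⟧N-cong; correct)

  Poly : Set
  Poly = Polynomial 2

  𝑥 𝑛 : Poly
  𝑥 = var zero
  𝑛 = var (suc zero)

  lit : ℕ → Poly
  lit k = con (+ k)

  ⟦_⟧ₓ : Poly → ℤ
  ⟦ p ⟧ₓ = ⟦ p ⟧ (x ∷ + N ∷ [])

  _≟ₚ_ : Poly → Poly → Bool
  p ≟ₚ q = is-just (normalise p ≟N normalise q)

  ≟ₚ-sound : ∀ p q → T (p ≟ₚ q) → ⟦ p ⟧ₓ ≡ ⟦ q ⟧ₓ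
  ≟ₚ-sound p q holds with normalise p ≟N normalise q
  ... | just p≈q = trans (sym (correct p _)) (trans (⟦ p≈q ⟧N-cong _) (correct q _))

  Entries : Set
  Entries = Position → Poly

  matrix : Entries → Matrix (N ℕ.+ N)
  matrix G r c = ⟦ G (position r c) ⟧ₓ

  _≐_ : Entries → Entries → Bool
  G ≐ H = allPositions (λ p → not (occurs p) ∨ (G p ≟ₚ H p))

  ≐-sound : ∀ G H → T (G ≐ H) → ∀ r c → matrix G r c ≡ matrix H r c
  ≐-sound G H holds r c = ≟ₚ-sound (G (position r c)) (H (position r c))
    (at-occurring (position-occurs r c) (allPositions-sound (λ p → not (occurs p) ∨ (G p ≟ₚ H p)) holds (position r c)))
    where
    at-occurring : ∀ {o b} → T o → T (not o ∨ b) → T b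
    at-occurring {true} _ holds = holds

  ∑ₚ : (Kind → Poly) → Poly
  ∑ₚ g = g ε :+ (g ρ₁ :+ ((𝑛 :- lit 2) :* g ρ :+ (g τ₀ :+ (𝑛 :- lit 1) :* g τ)))

  rowSum : (Kind → Position → Poly) → Kind → Poly
  rowSum H k = ∑ₚ (λ k′ → H k′ (offDiagonal k k′)) :+ (H k (diagonal k) :- H k (offDiagonal k k))

  -- by computation, since ⟦ 𝑛 :- lit 2 ⟧ₓ and ⟦ 𝑛 :- lit 1 ⟧ₓ reduce to + suc d and + suc (suc d)
  sum-row-poly : ∀ H r → sum (λ l → ⟦ H (kind l) (position r l) ⟧ₓ) ≡ ⟦ rowSum H (kind r) ⟧ₓ
  sum-row-poly H r = sum-row (λ k p → ⟦ H k p ⟧ₓ) r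

  columnOperation : Entries → (Kind → Kind → Poly) → Entries
  columnOperation G W p = G p :+ rowSum (λ k q → W k (columnKind p) :* G q) (rowKind p)

  matrix-columnOperation : ∀ G W r c →
    matrix (columnOperation G W) r c ≡ matrix G r c + sum (λ l → ⟦ W (kind l) (kind c) ⟧ₓ * matrix G r l)
  matrix-columnOperation G W r c = cong (_+_ (matrix G r c)) (begin
    ⟦ rowSum (λ k q → W k (columnKind (position r c)) :* G q) (rowKind (position r c)) ⟧ₓ
      ≡⟨ cong₂ (λ k₁ k₂ → ⟦ rowSum (λ k q → W k k₂ :* G q) k₁ ⟧ₓ)
               (rowKind-position r c) (columnKind-position r c) ⟩
    ⟦ rowSum (λ k q → W k (kind c) :* G q) (kind r) ⟧ₓ
      ≡⟨ sum-row-poly (λ k q → W k (kind c) :* G q) r ⟨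
    sum (λ l → ⟦ W (kind l) (kind c) ⟧ₓ * matrix G r l) ∎)

  guarded : (Kind → Bool) → (Kind → Kind → Poly) → Kind → Kind → Poly
  guarded source W k k′ = if source k ∧ not (source k′) then W k k′ else lit 0

  guarded-from-target : ∀ source W {k} k′ → source k ≡ false → guarded source W k k′ ≡ lit 0
  guarded-from-target source W k′ k-target rewrite k-target = refl

  guarded-to-source : ∀ source W k {k′} → source k′ ≡ true → guarded source W k k′ ≡ lit 0
  guarded-to-source source W k k′-source rewrite k′-source with source k
  ... | true  = refl
  ... | false = refl

  columnPhase : ∀ G′ G source W → T (G′ ≐ columnOperation G (guarded source W)) → det (matrix G′) ≡ det (matrix G)
  columnPhase G′ G source W holds = begin
    det (matrix G′)
      ≡⟨ det-cong {A = matrix G′} {B = matrix G″} (≐-sound G′ G″ holds) ⟩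
    det (matrix G″)
      ≡⟨ det-simultaneous-column-operations {A = matrix G} {C = matrix G″} weight (source ∘ kind)
          (λ l c eq → cong ⟦_⟧ₓ (guarded-from-target source W (kind c) eq))
          (λ l c eq → cong ⟦_⟧ₓ (guarded-to-source source W (kind l) eq))
          (matrix-columnOperation G (guarded source W)) ⟩
    det (matrix G) ∎
    where
    G″ : Entries
    G″ = columnOperation G (guarded source W)
    weight : Fin (N ℕ.+ N) → Fin (N ℕ.+ N) → ℤ
    weight l c = ⟦ guarded source W (kind l) (kind c) ⟧ₓ

  scaled : (Kind → Poly) → Entries → Entries
  scaled s G p = s (columnKind p) :* G p

  det-scaled : ∀ s G → det (matrix (scaled s G)) ≡ ∏ᵏ (⟦_⟧ₓ ∘ s) * det (matrix G)
  det-scaled s G = begin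
    det (matrix (scaled s G))
      ≡⟨ det-scale-columns factor {A = matrix G} {C = matrix (scaled s G)} scale ⟩
    product factor * det (matrix G)
      ≡⟨ cong (_* det (matrix G)) (product-by-kind (⟦_⟧ₓ ∘ s)) ⟩
    ∏ᵏ (⟦_⟧ₓ ∘ s) * det (matrix G) ∎
    where
    factor : Fin (N ℕ.+ N) → ℤ
    factor c = ⟦ s (kind c) ⟧ₓ
    scale : ∀ r c → matrix (scaled s G) r c ≡ factor c * matrix G r c
    scale r c = cong (λ k → ⟦ s k ⟧ₓ * matrix G r c) (columnKind-position r c)

  adjacency : Entries
  adjacency (diagonal _)       = lit 0
  adjacency (offDiagonal k k′) = if adjacent k k′ then lit 1 else lit 0

  degree : Kind → Poly
  degree = rowSum (λ _ → adjacency)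

  characteristic : Entries
  characteristic (diagonal k)       = 𝑥 :- degree k
  characteristic (offDiagonal k k′) = adjacency (offDiagonal k k′)

  -- Phase 1: subtract column ρ₁ from the ρ columns and column τ₀ from the τ columns; these become
  -- multiples of x - n and x - n - 1 respectively.
  sources₁ : Kind → Bool
  sources₁ ρ₁ = true
  sources₁ τ₀ = true
  sources₁ _  = false

  weights₁ : Kind → Kind → Poly
  weights₁ ρ₁ ρ = :- lit 1
  weights₁ τ₀ τ = :- lit 1
  weights₁ _  _ = lit 0

  scaling₁ : Kind → Poly
  scaling₁ ρ = 𝑥 :- 𝑛
  scaling₁ τ = 𝑥 :- (𝑛 :+ lit 1)
  scaling₁ _ = lit 1

  reduced₁ : Entries
  reduced₁ (diagonal ρ)       = lit 1
  reduced₁ (offDiagonal ρ₁ ρ) = :- lit 1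
  reduced₁ (offDiagonal _  ρ) = lit 0
  reduced₁ (diagonal τ)       = lit 1
  reduced₁ (offDiagonal τ₀ τ) = :- lit 1
  reduced₁ (offDiagonal _  τ) = lit 0
  reduced₁ p                  = characteristic p

  phase₁ : T (scaled scaling₁ reduced₁ ≐ columnOperation characteristic (guarded sources₁ weights₁))
  phase₁ = tt

  sources₂ : Kind → Bool
  sources₂ ρ = true
  sources₂ τ = true
  sources₂ _ = false

  weights₂ : Kind → Kind → Poly
  weights₂ ρ ε  = :- lit 1
  weights₂ τ ε  = :- lit 1
  weights₂ ρ ρ₁ = :- lit 1
  weights₂ τ τ₀ = :- lit 1
  weights₂ _ _  = lit 0

  reduced₂ : Entries
  reduced₂ (diagonal ε)        = 𝑥 :- (lit 2 :* 𝑛 :- lit 1)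
  reduced₂ (offDiagonal ρ₁ ε)  = 𝑛 :- lit 1
  reduced₂ (offDiagonal τ₀ ε)  = 𝑛
  reduced₂ (offDiagonal _  ε)  = lit 0
  reduced₂ (diagonal ρ₁)       = 𝑥 :- lit 1
  reduced₂ (offDiagonal ε  ρ₁) = lit 1
  reduced₂ (offDiagonal _  ρ₁) = lit 0
  reduced₂ (diagonal τ₀)       = 𝑥 :- lit 1
  reduced₂ (offDiagonal ε  τ₀) = lit 1
  reduced₂ (offDiagonal _  τ₀) = lit 0
  reduced₂ p                   = reduced₁ p

  phase₂ : T (reduced₂ ≐ columnOperation reduced₁ (guarded sources₂ weights₂))
  phase₂ = tt

  -- Phase 3: subtract column ρ₁ from column τ₀, which becomes a multiple of x - 1.
  sources₃ : Kind → Bool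
  sources₃ ρ₁ = true
  sources₃ _  = false

  weights₃ : Kind → Kind → Poly
  weights₃ ρ₁ τ₀ = :- lit 1
  weights₃ _  _  = lit 0

  scaling₃ : Kind → Poly
  scaling₃ τ₀ = 𝑥 :- lit 1
  scaling₃ _  = lit 1

  reduced₃ : Entries
  reduced₃ (diagonal τ₀)       = lit 1
  reduced₃ (offDiagonal ρ₁ τ₀) = :- lit 1
  reduced₃ (offDiagonal _  τ₀) = lit 0
  reduced₃ p                   = reduced₂ p

  phase₃ : T (scaled scaling₃ reduced₃ ≐ columnOperation reduced₂ (guarded sources₃ weights₃))
  phase₃ = tt

  -- Phase 4: clear column ε with columns ρ₁ and τ₀ except in row ρ₁, leaving cofactor there.
  sources₄ : Kind → Bool
  sources₄ ρ₁ = true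
  sources₄ τ₀ = true
  sources₄ _  = false

  weights₄ : Kind → Kind → Poly
  weights₄ ρ₁ ε = :- (𝑥 :- (lit 2 :* 𝑛 :- lit 1))
  weights₄ τ₀ ε = :- 𝑛
  weights₄ _  _ = lit 0

  cofactor : Poly
  cofactor = (lit 2 :* 𝑛 :- lit 1) :- (𝑥 :- (lit 2 :* 𝑛 :- lit 1)) :* (𝑥 :- lit 1)

  reduced₄ : Entries
  reduced₄ (diagonal ε)        = lit 0
  reduced₄ (diagonal ρ₁)       = 𝑥 :- lit 1
  reduced₄ (diagonal _)        = lit 1
  reduced₄ (offDiagonal ε  ρ₁) = lit 1
  reduced₄ (offDiagonal ε  _)  = lit 0
  reduced₄ (offDiagonal ρ₁ ε)  = cofactor
  reduced₄ (offDiagonal ρ₁ ρ)  = :- lit 1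
  reduced₄ (offDiagonal ρ₁ τ₀) = :- lit 1
  reduced₄ (offDiagonal ρ₁ _)  = lit 0
  reduced₄ (offDiagonal τ₀ τ)  = :- lit 1
  reduced₄ (offDiagonal _  _)  = lit 0

  phase₄ : T (reduced₄ ≐ columnOperation reduced₃ (guarded sources₄ weights₄))
  phase₄ = tt

  reduced₄-first-row : ∀ j → j ≢ suc zero → matrix reduced₄ zero j ≡ + 0
  reduced₄-first-row zero    _   = refl
  reduced₄-first-row (suc j) j≢1 = entry (kind (suc j)) (kind-range (suc j))
    where
    entry : ∀ k → KindRange k (suc (toℕ j)) → ⟦ reduced₄ (offDiagonal ε k) ⟧ₓ ≡ + 0
    entry ρ₁ 1+j≡1 = ⊥-elim (j≢1 (cong suc (Fin.toℕ-injective {j = zero} (ℕ.suc-injective 1+j≡1))))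
    entry ρ  _     = refl
    entry τ₀ _     = refl
    entry τ  _     = refl

  reduced₄-diagonal : ∀ t → 2 ℕ.≤ toℕ t → matrix reduced₄ t t ≡ + 1
  reduced₄-diagonal t 2≤t = trans (cong (⟦_⟧ₓ ∘ reduced₄) (position-diagonal t)) (entry (kind t) (kind-range t))
    where
    entry : ∀ k → KindRange k (toℕ t) → ⟦ reduced₄ (diagonal k) ⟧ₓ ≡ + 1
    entry ε  t≡0 = contradiction (subst (2 ℕ.≤_) t≡0 2≤t) λ ()
    entry ρ₁ t≡1 = contradiction (subst (2 ℕ.≤_) t≡1 2≤t) λ { (s≤s ()) }
    entry ρ  _   = refl
    entry τ₀ _   = refl
    entry τ  _   = refl

  reduced₄-below-diagonal : ∀ t u → 2 ℕ.≤ toℕ t → toℕ u ℕ.< toℕ t → matrix reduced₄ t u ≡ + 0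
  reduced₄-below-diagonal t u 2≤t u<t =
    trans (cong (⟦_⟧ₓ ∘ reduced₄) (position-offDiagonal t≢u)) (entry (kind t) (kind u) (kind-range t) (kind-range u))
    where
    t≢u : t ≢ u
    t≢u refl = ℕ.<-irrefl refl u<t
    entry : ∀ k k′ → KindRange k (toℕ t) → KindRange k′ (toℕ u) → ⟦ reduced₄ (offDiagonal k k′) ⟧ₓ ≡ + 0
    entry ε  _            t≡0 _   = contradiction (subst (2 ℕ.≤_) t≡0 2≤t) λ ()
    entry ρ₁ _            t≡1 _   = contradiction (subst (2 ℕ.≤_) t≡1 2≤t) λ { (s≤s ()) }
    entry ρ  _            _   _   = refl
    entry τ  _            _   _   = refl
    entry τ₀ ε            _   _   = refl
    entry τ₀ (rotation _) _   _   = refl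
    entry τ₀ τ₀           _   _   = refl
    entry τ₀ τ            t≡N N<u = contradiction (subst (ℕ._< toℕ u) (sym t≡N) N<u) (ℕ.<-asym u<t)

  -- Expanding along the first row leaves an upper triangular minor with diagonal cofactor, 1, …, 1.
  det-reduced₄ : det (matrix reduced₄) ≡ - ⟦ cofactor ⟧ₓ
  det-reduced₄ = begin
    det M
      ≡⟨ det-row-single M (suc zero) reduced₄-first-row ⟩
    - + 1 * (+ 1 * det (minor M (suc zero)))
      ≡⟨ cong (λ D → - + 1 * (+ 1 * D)) minor-det ⟩
    - + 1 * (+ 1 * ⟦ cofactor ⟧ₓ)
      ≡⟨ unit (⟦ cofactor ⟧ₓ) ⟩
    - ⟦ cofactor ⟧ₓ ∎
    where
    M = matrix reduced₄
    unit : ∀ c → - + 1 * (+ 1 * c) ≡ - c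
    unit = solve-∀
    upper : ∀ r c → toℕ c ℕ.< toℕ r → minor M (suc zero) r c ≡ + 0
    upper r zero    0<r = reduced₄-below-diagonal (suc r) zero (s≤s 0<r) (s≤s z≤n)
    upper r (suc c) c<r = reduced₄-below-diagonal (suc r) (suc (suc c)) (s≤s (ℕ.≤-trans (s≤s z≤n) c<r)) (s≤s c<r)
    diagonal-one : ∀ i → i ≢ zero → minor M (suc zero) i i ≡ + 1
    diagonal-one zero    i≢0 = ⊥-elim (i≢0 refl)
    diagonal-one (suc i) _   = reduced₄-diagonal (suc (suc i)) (s≤s (s≤s z≤n))
    minor-det : det (minor M (suc zero)) ≡ ⟦ cofactor ⟧ₓ
    minor-det = trans (det-upper-triangular (minor M (suc zero)) upper) (product-single _ zero diagonal-one)

  det-reduced₁ : det (matrix reduced₁) ≡ (x - + 1) * - ⟦ cofactor ⟧ₓ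
  det-reduced₁ = begin
    det (matrix reduced₁)
      ≡⟨ columnPhase reduced₂ reduced₁ sources₂ weights₂ phase₂ ⟨
    det (matrix reduced₂)
      ≡⟨ columnPhase (scaled scaling₃ reduced₃) reduced₂ sources₃ weights₃ phase₃ ⟨
    det (matrix (scaled scaling₃ reduced₃))
      ≡⟨ det-scaled scaling₃ reduced₃ ⟩
    ∏ᵏ (⟦_⟧ₓ ∘ scaling₃) * det (matrix reduced₃)
      ≡⟨ cong₂ _*_ scaling₃-product (sym (columnPhase reduced₄ reduced₃ sources₄ weights₄ phase₄)) ⟩
    (x - + 1) * det (matrix reduced₄)
      ≡⟨ cong ((x - + 1) *_) det-reduced₄ ⟩
    (x - + 1) * - ⟦ cofactor ⟧ₓ ∎
    where
    unit : ∀ y → (+ 1 * (+ 1 * + 1)) * (y * + 1) ≡ y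
    unit = solve-∀
    scaling₃-product : ∏ᵏ (⟦_⟧ₓ ∘ scaling₃) ≡ x - + 1
    scaling₃-product = trans (cong₂ (λ a b → (+ 1 * (+ 1 * a)) * ((x - + 1) * b))
                                    (ℤ.^-zeroˡ (suc d)) (ℤ.^-zeroˡ (suc (suc d))))
                             (unit (x - + 1))

  module _ (h : ℕ) (N≡2h+1 : N ≡ suc (2 ℕ.* h)) (A : Matrix (N ℕ.+ N))
           (A-adjacency : ∀ i j → (A i j ≡ + 1 × Dihedral.Adj N (Dihedral.elem N i) (Dihedral.elem N j))
                                 ⊎ (A i j ≡ + 0 × ¬ Dihedral.Adj N (Dihedral.elem N i) (Dihedral.elem N j))) where

    open Dihedral N using (elem; Adj)
    open DihedralProperties N using (Linked)

    adjacency-matrix : ∀ i j → A i j ≡ matrix adjacency i j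
    adjacency-matrix i j = byCases (i Fin.≟ j)
      where
      byCases : Dec (i ≡ j) → A i j ≡ matrix adjacency i j
      byCases (yes refl) = trans (no-loop (λ { (elemᵢ≢elemᵢ , _) → elemᵢ≢elemᵢ refl }))
                                 (cong (⟦_⟧ₓ ∘ adjacency) (sym (position-diagonal i)))
        where
        no-loop : ¬ Adj (elem i) (elem i) → A i i ≡ + 0
        no-loop ¬adj with A-adjacency i i
        ... | inj₁ (_ , adj) = contradiction adj ¬adj
        ... | inj₂ (A≡0 , _) = A≡0
      byCases (no i≢j) = trans (entry (adjacent (kind i) (kind j)) (linked-reflects h N≡2h+1 i j))
                               (cong (⟦_⟧ₓ ∘ adjacency) (sym (position-offDiagonal i≢j)))
        where
        entry : ∀ b → Reflects (Linked (elem i) (elem j)) b → A i j ≡ ⟦ if b then lit 1 else lit 0 ⟧ₓ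
        entry true (ofʸ linked) with A-adjacency i j
        ... | inj₁ (A≡1 , _)  = A≡1
        ... | inj₂ (_ , ¬adj) = contradiction (i≢j ∘ elem-injective i j , linked) ¬adj
        entry false (ofⁿ ¬linked) with A-adjacency i j
        ... | inj₁ (_ , adj)  = contradiction (proj₂ adj) ¬linked
        ... | inj₂ (A≡0 , _)  = A≡0

    characteristic-matrix : ∀ i j → x * δ i j - laplacian A i j ≡ matrix characteristic i j
    characteristic-matrix i j = byCases (i Fin.≟ j)
      where
      byCases : Dec (i ≡ j) → x * δ i j - laplacian A i j ≡ matrix characteristic i j
      byCases (yes refl) = begin
        x * δ i i - (δ i i * sumFin (A i) - A i i)
          ≡⟨ cong₂ (λ δᵢ s → x * δᵢ - (δᵢ * s - A i i)) (δ-diagonal i) row-sum ⟩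
        x * + 1 - (+ 1 * ⟦ degree (kind i) ⟧ₓ - A i i)
          ≡⟨ cong (λ a → x * + 1 - (+ 1 * ⟦ degree (kind i) ⟧ₓ - a)) no-loop ⟩
        x * + 1 - (+ 1 * ⟦ degree (kind i) ⟧ₓ - + 0)
          ≡⟨ simplify x ⟦ degree (kind i) ⟧ₓ ⟩
        x - ⟦ degree (kind i) ⟧ₓ
          ≡⟨ cong (⟦_⟧ₓ ∘ characteristic) (position-diagonal i) ⟨
        matrix characteristic i i ∎
        where
        simplify : ∀ x d → x * + 1 - (+ 1 * d - + 0) ≡ x - d
        simplify = solve-∀
        no-loop : A i i ≡ + 0
        no-loop = trans (adjacency-matrix i i) (cong (⟦_⟧ₓ ∘ adjacency) (position-diagonal i))
        row-sum : sumFin (A i) ≡ ⟦ degree (kind i) ⟧ₓ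
        row-sum = trans (sumFin≡sum (A i)) (trans (sum-cong-≗ (adjacency-matrix i)) (sum-row-poly (λ _ → adjacency) i))
      byCases (no i≢j) = begin
        x * δ i j - (δ i j * sumFin (A i) - A i j)
          ≡⟨ cong (λ δᵢⱼ → x * δᵢⱼ - (δᵢⱼ * sumFin (A i) - A i j)) (δ-offDiagonal i≢j) ⟩
        x * + 0 - (+ 0 * sumFin (A i) - A i j)
          ≡⟨ simplify x (sumFin (A i)) (A i j) ⟩
        A i j
          ≡⟨ adjacency-matrix i j ⟩
        matrix adjacency i j
          ≡⟨ cong (⟦_⟧ₓ ∘ adjacency) (position-offDiagonal i≢j) ⟩
        ⟦ adjacency (offDiagonal (kind i) (kind j)) ⟧ₓ
          ≡⟨ cong (⟦_⟧ₓ ∘ characteristic) (position-offDiagonal i≢j) ⟨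
        matrix characteristic i j ∎
        where
        simplify : ∀ x s a → x * + 0 - (+ 0 * s - a) ≡ a
        simplify = solve-∀

    charPoly-laplacian : charPoly (laplacian A) x
      ≡ x * ((x - + 1) * (((x - + N) ℤ.^ (N ℕ.∸ 2)) * (((x - + (N ℕ.+ 1)) ℤ.^ (N ℕ.∸ 1)) * (x - + (2 ℕ.* N)))))
    charPoly-laplacian = begin
      charPoly (laplacian A) x
        ≡⟨ det-cong characteristic-matrix ⟩
      det (matrix characteristic)
        ≡⟨ columnPhase (scaled scaling₁ reduced₁) characteristic sources₁ weights₁ phase₁ ⟨
      det (matrix (scaled scaling₁ reduced₁))
        ≡⟨ det-scaled scaling₁ reduced₁ ⟩
      ∏ᵏ (⟦_⟧ₓ ∘ scaling₁) * det (matrix reduced₁)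
        ≡⟨ cong (∏ᵏ (⟦_⟧ₓ ∘ scaling₁) *_) det-reduced₁ ⟩
      ∏ᵏ (⟦_⟧ₓ ∘ scaling₁) * ((x - + 1) * - ⟦ cofactor ⟧ₓ)
        ≡⟨ expand x (+ N) P Q ⟩
      x * ((x - + 1) * (P * (Q * (x - + 2 * + N))))
        ≡⟨ cong₂ (λ q t → x * ((x - + 1) * (P * (q ℤ.^ suc (suc d) * (x - t)))))
            (cong (_-_ x) (ℤ.pos-+ N 1)) (ℤ.pos-* 2 N) ⟨
      x * ((x - + 1) * (P * ((x - + (N ℕ.+ 1)) ℤ.^ suc (suc d) * (x - + (2 ℕ.* N))))) ∎
      where
      P Q : ℤ
      P = (x - + N) ℤ.^ suc d
      Q = (x - (+ N + + 1)) ℤ.^ suc (suc d)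
      expand : ∀ x n P Q → ((+ 1 * (+ 1 * P)) * (+ 1 * Q)) * ((x - + 1) * - ((+ 2 * n - + 1) - (x - (+ 2 * n - + 1)) * (x - + 1)))
                         ≡ x * ((x - + 1) * (P * (Q * (x - + 2 * n))))
      expand = solve-∀

mainTheorem3 : (n : ℕ) .{{_ : NonZero n}} → 3 ℕ.≤ n → ∃[ k ] n ≡ suc (2 ℕ.* k) →
    (A : Matrix (n ℕ.+ n)) →
    (∀ i j → (A i j ≡ + 1 × Dihedral.Adj n (Dihedral.elem n i) (Dihedral.elem n j))
           ⊎ (A i j ≡ + 0 × ¬ Dihedral.Adj n (Dihedral.elem n i) (Dihedral.elem n j))) →
    ∀ (x : ℤ) → charPoly (laplacian A) x
      ≡ x ℤ.* ((x ℤ.- + 1) ℤ.* (((x ℤ.- + n) ℤ.^ (n ℕ.∸ 2))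
          ℤ.* (((x ℤ.- + (n ℕ.+ 1)) ℤ.^ (n ℕ.∸ 1)) ℤ.* (x ℤ.- + (2 ℕ.* n)))))
mainTheorem3 (suc (suc (suc d))) (s≤s (s≤s (s≤s _))) (h , n≡2h+1) A A-adjacency x =
  Reduction.charPoly-laplacian d x h n≡2h+1 A A-adjacency
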